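{- Let $(p_1,\ldots,p_{n-1})$ be an admissible $(n-1)$-tuple with the property that for every $i$ with $1<i<n-1$, either $p_i=2$ or $p_{i-1}=p_{i+1}=2$. Then in $\Gamma(p_1,\ldots,p_{n-1})$ the element $y_i=x_{i-1}x_i$ has order $p_i$ for all $1\le i\le n-1$, and $|\Gamma(p_1,\ldots,p_{n-1})|=2p_1\cdots p_{n-1}$.
   Context: An $(n-1)$-tuple $(p_1,\ldots,p_{n-1})$ of integers $\ge 2$ is admissible if whenever $p_i$ is odd, each of $p_{i-1}$ and $p_{i+1}$ (when its index lies in $\{1,\ldots,n-1\}$) is an even divisor of $2p_i$. For such a tuple, $\Gamma(p_1,\ldots,p_{n-1})$ is the group generated by $x_0,\ldots,x_{n-1}$ subject to $x_j^2=1$, $(x_{j-1}x_j)^{p_j}=1$ ($1\le j\le n-1$), $(x_jx_k)^2=1$ for $|j-k|\ge 2$, and $r_j=1$ for $1\le j\le n-2$, where $r_j=(x_{j-1}x_jx_{j+1}x_j)^2$ if $p_j,p_{j+1}$ are both even, $r_j=(x_{j-1}x_jx_{j+1}x_jx_{j+1})^2$ if $p_j$ is odd and $p_{j+1}$ even, and $r_j=(x_{j+1}x_jx_{j-1}x_jx_{j-1})^2$ if $p_j$ is even and $p_{j+1}$ odd. -}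

module Defs where

open import Data.Nat using (ℕ; zero; suc; _+_; _*_; _∸_; _≤_; _<_; _<?_)
open import Data.Nat.Divisibility using (_∣_; _∣?_)
open import Data.Fin using (Fin; fromℕ<)
open import Data.List using (List; []; _∷_; _++_)
open import Data.Bool using (true; false)
open import Data.Product using (Σ; _×_; ∃)
open import Data.Sum using (_⊎_)
open import Relation.Nullary using (¬_; yes; no; does)
open import Relation.Binary.PropositionalEquality using (_≡_)

-- Conventions: n = suc m (so the tuple is (p 1, …, p m), m = n - 1).
-- The tuple is given as a function p : ℕ → ℕ of which only the values
-- p 1, …, p m are ever used.

Even Odd : ℕ → Set
Even k = 2 ∣ k
Odd k = ¬ (2 ∣ k)

Admissible : (m : ℕ) → (ℕ → ℕ) → Set
Admissible m p =
  (∀ i → 1 ≤ i → i ≤ m → 2 ≤ p i) ×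
  (∀ i → 1 ≤ i → i ≤ m → Odd (p i) →
     ((2 ≤ i → Even (p (i ∸ 1)) × (p (i ∸ 1) ∣ 2 * p i)) ×
      (i + 1 ≤ m → Even (p (i + 1)) × (p (i + 1) ∣ 2 * p i))))

prodP : (ℕ → ℕ) → ℕ → ℕ
prodP p zero = 1
prodP p (suc k) = prodP p k * p (suc k)

module Presentation (m : ℕ) (p : ℕ → ℕ) where

  -- words in the generators x 0, …, x m (all generators are involutions,
  -- so words need no inverse letters)
  Word : Set
  Word = List (Fin (suc m))

  -- the one-letter word x_j (only used for j ≤ m)
  x : ℕ → Word
  x j with j <? suc m
  ... | yes j<n = fromℕ< j<n ∷ []
  ... | no _ = []

  pow : Word → ℕ → Word
  pow w zero = []
  pow w (suc k) = w ++ pow w k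

  -- r_j  (the case p_j, p_{j+1} both odd cannot occur for admissible tuples)
  r : ℕ → Word
  r j with does (2 ∣? p j) | does (2 ∣? p (suc j))
  ... | true  | true  = pow (x (j ∸ 1) ++ x j ++ x (suc j) ++ x j) 2
  ... | false | true  = pow (x (j ∸ 1) ++ x j ++ x (suc j) ++ x j ++ x (suc j)) 2
  ... | true  | false = pow (x (suc j) ++ x j ++ x (j ∸ 1) ++ x j ++ x (j ∸ 1)) 2
  ... | false | false = []

  data IsRelator : Word → Set where
    rel-inv  : ∀ j → j ≤ m → IsRelator (pow (x j) 2)
    rel-p    : ∀ j → 1 ≤ j → j ≤ m → IsRelator (pow (x (j ∸ 1) ++ x j) (p j))
    rel-comm : ∀ j k → j ≤ m → k ≤ m → (2 ≤ k ∸ j ⊎ 2 ≤ j ∸ k) →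
               IsRelator (pow (x j ++ x k) 2)
    rel-r    : ∀ j → 1 ≤ j → j + 2 ≤ suc m → IsRelator (r j)

  -- equality in Γ(p_1,…,p_{n-1}): the congruence generated by the relators
  infix 4 _~_
  data _~_ : Word → Word → Set where
    ~refl  : ∀ {w} → w ~ w
    ~sym   : ∀ {u v} → u ~ v → v ~ u
    ~trans : ∀ {u v w} → u ~ v → v ~ w → u ~ w
    ~ins   : ∀ {ρ} → IsRelator ρ → ∀ u v → (u ++ v) ~ (u ++ ρ ++ v)

  y : ℕ → Word
  y i = x (i ∸ 1) ++ x i

  HasOrder : Word → ℕ → Set
  HasOrder w k = 1 ≤ k × (pow w k ~ []) × (∀ j → 1 ≤ j → j < k → ¬ (pow w j ~ []))

  HasCard : ℕ → Set
  HasCard N = Σ (Fin N → Word) λ f →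
    (∀ a b → f a ~ f b → a ≡ b) × (∀ w → ∃ λ a → w ~ f a)

-- The normal forms x₀^e y₁^{r₁} ⋯ y_{n−1}^{r_{n−1}} (e < 2, r_i < p_i) represent every element of Γ:
-- a letter appended to a normal form moves left through the powers of the y_i, by the dihedral relations of
-- ⟨x_{i−1}, x_i⟩, by commutation with far letters, and, for x_{i−2}, by a relation y_i^r x_{i−2} =
-- w y_i^s with w ∈ ⟨x₀, …, x_{i−1}⟩. The hypothesis provides the latter: if p_{i−1} = 2 or p_i = 2 it
-- follows from the Coxeter-type relators, and in the only other case, n − 1 = 2, from the relator r₁.
-- Conversely, for each K there is an action of Γ with a point fixed by x₀, …, x_{K−1} on whose orbit
-- y_K acts as a p_K-cycle: when p_K = 2 the parity of the number of letters x_j with j ≥ K, and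
-- otherwise the dihedral action on ℤ/p_K in which x_{K−1} and x_K are the reflections z ↦ −z and
-- z ↦ 1 − z and the other generators act trivially; the relators hold because then p_{K−1} and
-- p_{K+1} are even. For n − 1 = 2 with an odd p_i two further actions are built by hand. Peeling off
-- the last factor with these actions shows that the normal forms are pairwise distinct, and the
-- same actions give the order of y_K.
module Submission where

open import Defs
open import Data.Nat using (ℕ; zero; suc; _+_; _*_; _∸_; _≤_; _<_; z≤n; s≤s; _<?_; _≤?_; _≟_; >-nonZero)
open import Data.Nat.Properties
open import Data.Nat.DivMod using (_%_; _/_; m%n<n; m≡m%n+[m/n]*n; m<n⇒m%n≡m)
open import Data.Nat.Divisibility using (_∣_; _∣?_; divides; n∣m⇒m%n≡0)
open import Data.Nat.Tactic.RingSolver renaming (solve-∀ to ℕ-solve-∀)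
open import Data.Integer using (ℤ; +_; ∣_∣) renaming (_+_ to _+ℤ_; _-_ to _-ℤ_; -_ to -ℤ_; _*_ to _*ℤ_)
import Data.Integer.Properties as ℤ
open import Data.Integer.Divisibility.Signed using (∣⇒∣ᵤ; ∣m∣n⇒∣m+n; ∣m⇒∣-m) renaming (_∣_ to _∣ℤ_; divides to dividesℤ)
open import Data.Integer.Tactic.RingSolver using (solve-∀)
open import Data.Fin using (Fin; toℕ; fromℕ<; remQuot; combine) renaming (zero to fzero; suc to fsuc)
open import Data.Fin.Properties using (toℕ-fromℕ<; fromℕ<-toℕ; toℕ<n; toℕ-injective; remQuot-combine; combine-remQuot)
open import Data.List using (List; []; _∷_; _++_; reverse)
open import Data.List.Properties using (++-assoc; ++-identityʳ; unfold-reverse)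
open import Data.List.Relation.Unary.All as All using (All; []; _∷_)
open import Data.List.Relation.Unary.All.Properties using (++⁺)
open import Data.Bool using (Bool; true; false; not; _xor_)
open import Data.Bool.Properties using (xor-assoc; xor-comm; xor-same; xor-identityʳ; not-involutive)
open import Data.Product using (Σ; _×_; _,_; proj₁; proj₂)
open import Data.Product.Relation.Binary.Pointwise.NonDependent using (_×ₛ_)
open import Data.Sum using (_⊎_; inj₁; inj₂)
open import Data.Empty using (⊥-elim)
open import Function using (_∘_)
open import Level using (0ℓ)
open import Relation.Binary.Bundles using (Setoid)
open import Relation.Binary.PropositionalEquality
open import Relation.Nullary using (¬_; Dec; yes; no; does)
open import Relation.Nullary.Decidable using (dec-true; dec-false)


Far : ℕ → ℕ → Set
Far j k = 2 ≤ k ∸ j ⊎ 2 ≤ j ∸ k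

n<2+n : ∀ n → n < 2 + n
n<2+n n = m<n⇒m<1+n (n<1+n n)

¬Far-self : ∀ j → ¬ Far j j
¬Far-self j (inj₁ 2≤0) with subst (2 ≤_) (n∸n≡0 j) 2≤0
... | ()
¬Far-self j (inj₂ 2≤0) with subst (2 ≤_) (n∸n≡0 j) 2≤0
... | ()

¬Far-suc : ∀ j → ¬ Far (suc j) j
¬Far-suc j (inj₁ 2≤0) with subst (2 ≤_) (m≤n⇒m∸n≡0 (n≤1+n j)) 2≤0
... | ()
¬Far-suc j (inj₂ 2≤1) with subst (2 ≤_) (m+n∸n≡m 1 j) 2≤1
... | s≤s ()

Far-sym : ∀ {j k} → Far j k → Far k j
Far-sym (inj₁ far) = inj₂ far
Far-sym (inj₂ far) = inj₁ far

far-within-2 : ∀ {j k} → 2 ≤ k ∸ j → k ≤ 2 → j ≡ 0 × k ≡ 2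
far-within-2 {zero} 2≤k k≤2 = refl , ≤-antisym k≤2 2≤k
far-within-2 {suc j} 2≤k∸1+j k≤2 = ⊥-elim (1+n≰n (≤-trans 2≤k∸1+j (∸-mono k≤2 (s≤s (z≤n {j})))))

even-or-odd : ∀ n → Σ ℕ λ c → n ≡ c * 2 ⊎ n ≡ suc (c * 2)
even-or-odd zero = 0 , inj₁ refl
even-or-odd (suc n) with even-or-odd n
... | c , inj₁ n≡2c = c , inj₂ (cong suc n≡2c)
... | c , inj₂ n≡2c+1 = suc c , inj₁ (cong suc n≡2c+1)

quotient-of-double : ∀ n d → d * 2 ∣ 2 * n → Σ ℕ λ a → n ≡ a * d
quotient-of-double n d (divides a 2n≡a*[d*2]) =
  a , *-cancelʳ-≡ n (a * d) 2 (trans (*-comm n 2) (trans 2n≡a*[d*2] (sym (*-assoc a d 2))))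

r-indices : ℕ → Bool → Bool → List ℕ
r-indices j true  true  = j ∸ 1 ∷ j ∷ suc j ∷ j ∷ []
r-indices j false true  = j ∸ 1 ∷ j ∷ suc j ∷ j ∷ suc j ∷ []
r-indices j true  false = suc j ∷ j ∷ j ∸ 1 ∷ j ∷ j ∸ 1 ∷ []
r-indices j false false = []

module Words (m : ℕ) (p : ℕ → ℕ) where
  open Presentation m p

  ≡⇒~ : ∀ {u v} → u ≡ v → u ~ v
  ≡⇒~ refl = ~refl

  relator~[] : ∀ {ρ} → IsRelator ρ → ρ ~ []
  relator~[] {ρ} r = ~sym (subst ([] ~_) (++-identityʳ ρ) (~ins r [] []))

  ++-congʳ : ∀ {u v} w → u ~ v → u ++ w ~ v ++ w
  ++-congʳ w ~refl = ~refl
  ++-congʳ w (~sym e) = ~sym (++-congʳ w e)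
  ++-congʳ w (~trans e f) = ~trans (++-congʳ w e) (++-congʳ w f)
  ++-congʳ w (~ins {ρ} r a b) =
    subst₂ _~_ (sym (++-assoc a b w))
      (sym (trans (++-assoc a (ρ ++ b) w) (cong (a ++_) (++-assoc ρ b w))))
      (~ins r a (b ++ w))

  ++-congˡ : ∀ w {u v} → u ~ v → w ++ u ~ w ++ v
  ++-congˡ w ~refl = ~refl
  ++-congˡ w (~sym e) = ~sym (++-congˡ w e)
  ++-congˡ w (~trans e f) = ~trans (++-congˡ w e) (++-congˡ w f)
  ++-congˡ w (~ins {ρ} r a b) = subst₂ _~_ (++-assoc w a b) (++-assoc w a (ρ ++ b)) (~ins r (w ++ a) b)

  ++-cong : ∀ {u u' v v'} → u ~ u' → v ~ v' → u ++ v ~ u' ++ v'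
  ++-cong {u' = u'} {v = v} e f = ~trans (++-congʳ v e) (++-congˡ u' f)

  ∷-cong : ∀ c {u v} → u ~ v → c ∷ u ~ c ∷ v
  ∷-cong c = ++-congˡ (c ∷ [])

  infixr 2 _~⟨_⟩_ _≡⟨_⟩_
  infix 3 _∎
  _~⟨_⟩_ : ∀ u {v w} → u ~ v → v ~ w → u ~ w
  u ~⟨ e ⟩ f = ~trans e f
  _≡⟨_⟩_ : ∀ u {v w} → u ≡ v → v ~ w → u ~ w
  u ≡⟨ refl ⟩ f = f
  _∎ : ∀ u → u ~ u
  u ∎ = ~refl

  letter : ∀ j → j ≤ m → Fin (suc m)
  letter j j≤m = fromℕ< (s≤s j≤m)

  toℕ-letter : ∀ j (j≤m : j ≤ m) → toℕ (letter j j≤m) ≡ j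
  toℕ-letter j j≤m = toℕ-fromℕ< (s≤s j≤m)

  x≡letter : ∀ j (j≤m : j ≤ m) → x j ≡ letter j j≤m ∷ []
  x≡letter j j≤m with j <? suc m
  ... | yes _ = refl
  ... | no j≮n = ⊥-elim (j≮n (s≤s j≤m))

  toℕ≤m : ∀ (c : Fin (suc m)) → toℕ c ≤ m
  toℕ≤m c = ≤-pred (toℕ<n c)

  x-toℕ : ∀ (c : Fin (suc m)) → x (toℕ c) ≡ c ∷ []
  x-toℕ c = trans (x≡letter (toℕ c) (toℕ≤m c)) (cong (_∷ []) (fromℕ<-toℕ c _))

  letter²~[] : ∀ c → c ∷ c ∷ [] ~ []
  letter²~[] c = subst (λ w → w ++ w ++ [] ~ []) (x-toℕ c) (relator~[] (rel-inv (toℕ c) (toℕ≤m c)))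

  cancel² : ∀ u c v → u ++ c ∷ c ∷ v ~ u ++ v
  cancel² u c v = ++-congˡ u (++-congʳ v (letter²~[] c))

  commute : ∀ c d → c ∷ d ∷ c ∷ d ∷ [] ~ [] → d ∷ c ∷ [] ~ c ∷ d ∷ []
  commute c d cdcd~[] =
    d ∷ c ∷ []                  ~⟨ ~sym (++-congˡ (d ∷ c ∷ []) cdcd~[]) ⟩
    d ∷ c ∷ c ∷ d ∷ c ∷ d ∷ []  ~⟨ cancel² (d ∷ []) c (d ∷ c ∷ d ∷ []) ⟩
    d ∷ d ∷ c ∷ d ∷ []          ~⟨ cancel² [] d (c ∷ d ∷ []) ⟩
    c ∷ d ∷ []                  ∎

  far-commute : ∀ c d → Far (toℕ c) (toℕ d) → d ∷ c ∷ [] ~ c ∷ d ∷ []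
  far-commute c d far = commute c d
    (subst₂ (λ s t → (s ++ t) ++ (s ++ t) ++ [] ~ []) (x-toℕ c) (x-toℕ d)
      (relator~[] (rel-comm (toℕ c) (toℕ d) (toℕ≤m c) (toℕ≤m d) far)))

  pow-+ : ∀ w a b → pow w (a + b) ≡ pow w a ++ pow w b
  pow-+ w zero b = refl
  pow-+ w (suc a) b = trans (cong (w ++_) (pow-+ w a b)) (sym (++-assoc w (pow w a) (pow w b)))

  pow-sucʳ : ∀ w n → pow w (suc n) ≡ pow w n ++ w
  pow-sucʳ w n = trans (cong (pow w) (+-comm 1 n)) (trans (pow-+ w n 1) (cong (pow w n ++_) (++-identityʳ w)))

  pow-* : ∀ w a b → pow w (a * b) ≡ pow (pow w b) a
  pow-* w zero b = refl
  pow-* w (suc a) b = trans (pow-+ w b (a * b)) (cong (pow w b ++_) (pow-* w a b))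

  pow-~[] : ∀ {w} n → w ~ [] → pow w n ~ []
  pow-~[] zero e = ~refl
  pow-~[] (suc n) e = ++-cong e (pow-~[] n e)

  ++-reverse~[] : ∀ w → w ++ reverse w ~ []
  ++-reverse~[] [] = ~refl
  ++-reverse~[] (c ∷ w) =
    c ∷ w ++ reverse (c ∷ w)       ≡⟨ cong (λ t → c ∷ w ++ t) (unfold-reverse c w) ⟩
    c ∷ w ++ reverse w ++ c ∷ []   ≡⟨ cong (c ∷_) (sym (++-assoc w (reverse w) (c ∷ []))) ⟩
    c ∷ (w ++ reverse w) ++ c ∷ [] ~⟨ ∷-cong c (++-congʳ (c ∷ []) (++-reverse~[] w)) ⟩
    c ∷ c ∷ []                     ~⟨ letter²~[] c ⟩
    []                             ∎

  xs : List ℕ → Word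
  xs [] = []
  xs (j ∷ []) = x j
  xs (j ∷ k ∷ js) = x j ++ xs (k ∷ js)

  r≡pow : ∀ j → r j ≡ pow (xs (r-indices j (does (2 ∣? p j)) (does (2 ∣? p (suc j))))) 2
  r≡pow j with does (2 ∣? p j) | does (2 ∣? p (suc j))
  ... | true  | true  = refl
  ... | false | true  = refl
  ... | true  | false = refl
  ... | false | false = refl

  ++-cancelʳ : ∀ u v w → u ++ w ~ v ++ w → u ~ v
  ++-cancelʳ u v w e =
    u                     ≡⟨ sym (++-identityʳ u) ⟩
    u ++ []               ~⟨ ~sym (++-congˡ u (++-reverse~[] w)) ⟩
    u ++ w ++ reverse w   ≡⟨ sym (++-assoc u w (reverse w)) ⟩
    (u ++ w) ++ reverse w ~⟨ ++-congʳ (reverse w) e ⟩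
    (v ++ w) ++ reverse w ≡⟨ ++-assoc v w (reverse w) ⟩
    v ++ w ++ reverse w   ~⟨ ++-congˡ v (++-reverse~[] w) ⟩
    v ++ []               ≡⟨ ++-identityʳ v ⟩
    v                     ∎

module Dihedral (m : ℕ) (p : ℕ → ℕ) (a b : Fin (suc m)) where
  open Presentation m p
  open Words m p

  D E : Word
  D = a ∷ b ∷ []
  E = b ∷ a ∷ []

  D^r·a≡a·E^r : ∀ r → pow D r ++ a ∷ [] ≡ a ∷ pow E r
  D^r·a≡a·E^r zero = refl
  D^r·a≡a·E^r (suc r) = cong (λ t → a ∷ b ∷ t) (D^r·a≡a·E^r r)

  E^r·D^r~[] : ∀ r → pow E r ++ pow D r ~ []
  E^r·D^r~[] zero = ~refl
  E^r·D^r~[] (suc r) =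
    pow E (suc r) ++ pow D (suc r)             ≡⟨ cong (_++ pow D (suc r)) (pow-sucʳ E r) ⟩
    (pow E r ++ E) ++ pow D (suc r)            ≡⟨ ++-assoc (pow E r) E (pow D (suc r)) ⟩
    pow E r ++ b ∷ a ∷ a ∷ b ∷ pow D r         ≡⟨ sym (++-assoc (pow E r) (b ∷ []) (a ∷ a ∷ b ∷ pow D r)) ⟩
    (pow E r ++ b ∷ []) ++ a ∷ a ∷ b ∷ pow D r ~⟨ cancel² (pow E r ++ b ∷ []) a (b ∷ pow D r) ⟩
    (pow E r ++ b ∷ []) ++ b ∷ pow D r         ≡⟨ ++-assoc (pow E r) (b ∷ []) (b ∷ pow D r) ⟩
    pow E r ++ b ∷ b ∷ pow D r                 ~⟨ cancel² (pow E r) b (pow D r) ⟩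
    pow E r ++ pow D r                         ~⟨ E^r·D^r~[] r ⟩
    []                                         ∎

  D^r·c~c·D^r : ∀ c → a ∷ c ∷ [] ~ c ∷ a ∷ [] → b ∷ c ∷ [] ~ c ∷ b ∷ [] →
                ∀ r → pow D r ++ c ∷ [] ~ c ∷ pow D r
  D^r·c~c·D^r c ac~ca bc~cb zero = ~refl
  D^r·c~c·D^r c ac~ca bc~cb (suc r) =
    a ∷ b ∷ (pow D r ++ c ∷ []) ~⟨ ++-congˡ D (D^r·c~c·D^r c ac~ca bc~cb r) ⟩
    a ∷ b ∷ c ∷ pow D r         ~⟨ ++-congˡ (a ∷ []) (++-congʳ (pow D r) bc~cb) ⟩
    a ∷ c ∷ b ∷ pow D r         ~⟨ ++-congʳ (b ∷ pow D r) ac~ca ⟩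
    c ∷ a ∷ b ∷ pow D r         ∎

  module OfOrder (P : ℕ) (1≤P : 1 ≤ P) (D^P~[] : pow D P ~ []) where

    E^r~D^[r*[P∸1]] : ∀ r → pow E r ~ pow D (r * (P ∸ 1))
    E^r~D^[r*[P∸1]] r =
      pow E r                                   ≡⟨ sym (++-identityʳ _) ⟩
      pow E r ++ []                             ~⟨ ~sym (++-congˡ (pow E r) (pow-~[] r D^P~[])) ⟩
      pow E r ++ pow (pow D P) r                ≡⟨ cong (pow E r ++_) (sym (pow-* D r P)) ⟩
      pow E r ++ pow D (r * P)                  ≡⟨ cong (λ t → pow E r ++ pow D t) r*P≡r+r*[P∸1] ⟩
      pow E r ++ pow D (r + r * (P ∸ 1))        ≡⟨ cong (pow E r ++_) (pow-+ D r _) ⟩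
      pow E r ++ pow D r ++ pow D (r * (P ∸ 1)) ≡⟨ sym (++-assoc (pow E r) _ _) ⟩
      (pow E r ++ pow D r) ++ pow D (r * (P ∸ 1)) ~⟨ ++-congʳ _ (E^r·D^r~[] r) ⟩
      pow D (r * (P ∸ 1))                       ∎
      where
      r*P≡r+r*[P∸1] : r * P ≡ r + r * (P ∸ 1)
      r*P≡r+r*[P∸1] = trans (cong (r *_) (sym (m+[n∸m]≡n 1≤P)))
                        (trans (*-distribˡ-+ r 1 (P ∸ 1)) (cong (_+ r * (P ∸ 1)) (*-identityʳ r)))

    D^r·a~a·D^s : ∀ r → pow D r ++ a ∷ [] ~ a ∷ pow D (r * (P ∸ 1))
    D^r·a~a·D^s r = ~trans (≡⇒~ (D^r·a≡a·E^r r)) (∷-cong a (E^r~D^[r*[P∸1]] r))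

    D^r·b~a·D^s : ∀ r → pow D r ++ b ∷ [] ~ a ∷ pow D (r * (P ∸ 1) + 1)
    D^r·b~a·D^s r =
      pow D r ++ b ∷ []             ~⟨ ~sym (++-congˡ (pow D r) (cancel² [] a (b ∷ []))) ⟩
      pow D r ++ a ∷ a ∷ b ∷ []     ≡⟨ sym (++-assoc (pow D r) (a ∷ []) D) ⟩
      (pow D r ++ a ∷ []) ++ D      ~⟨ ++-congʳ D (D^r·a~a·D^s r) ⟩
      a ∷ pow D (r * (P ∸ 1)) ++ D  ≡⟨ cong (a ∷_) (sym (pow-sucʳ D (r * (P ∸ 1)))) ⟩
      a ∷ pow D (suc (r * (P ∸ 1))) ≡⟨ cong (λ t → a ∷ pow D t) (+-comm 1 (r * (P ∸ 1))) ⟩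
      a ∷ pow D (r * (P ∸ 1) + 1)   ∎

-- Normal forms span Γ

module NormalForms (m : ℕ) (p : ℕ → ℕ) where
  open Presentation m p
  open Words m p

  LettersUpTo : ℕ → Word → Set
  LettersUpTo k = All (λ c → toℕ c ≤ k)

  LettersUpTo-x : ∀ {k} j → j ≤ k → LettersUpTo k (x j)
  LettersUpTo-x {k} j j≤k with j <? suc m
  ... | yes j<n = subst (_≤ k) (sym (toℕ-fromℕ< j<n)) j≤k ∷ []
  ... | no _ = []

  LettersUpTo-pow : ∀ {k w} n → LettersUpTo k w → LettersUpTo k (pow w n)
  LettersUpTo-pow zero _ = []
  LettersUpTo-pow (suc n) w≤ = ++⁺ w≤ (LettersUpTo-pow n w≤)

  LettersUpTo-mono : ∀ {k k' w} → k ≤ k' → LettersUpTo k w → LettersUpTo k' w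
  LettersUpTo-mono k≤k' = All.map (λ c≤k → ≤-trans c≤k k≤k')

  LettersUpTo-m : ∀ w → LettersUpTo m w
  LettersUpTo-m = All.universal toℕ≤m

  normalCount : ℕ → ℕ
  normalCount zero = 2
  normalCount (suc k) = normalCount k * p (suc k)

  normalCount≡2*prodP : ∀ k → normalCount k ≡ 2 * prodP p k
  normalCount≡2*prodP zero = refl
  normalCount≡2*prodP (suc k) =
    trans (cong (_* p (suc k)) (normalCount≡2*prodP k)) (*-assoc 2 (prodP p k) (p (suc k)))

  -- normalForm k enumerates the words x₀^e y₁^{r₁} ⋯ y_k^{r_k} with e < 2 and r_i < p i, indexed in mixed radix.
  normalForm : (k : ℕ) → Fin (normalCount k) → Word
  normalForm zero i = pow (x 0) (toℕ i)
  normalForm (suc k) i =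
    normalForm k (proj₁ (remQuot {normalCount k} (p (suc k)) i)) ++
    pow (y (suc k)) (toℕ (proj₂ (remQuot {normalCount k} (p (suc k)) i)))

  normalForm-combine : ∀ k q t → normalForm (suc k) (combine q t) ≡ normalForm k q ++ pow (y (suc k)) (toℕ t)
  normalForm-combine k q t =
    cong (λ (q , t) → normalForm k q ++ pow (y (suc k)) (toℕ t)) (remQuot-combine {normalCount k} {p (suc k)} q t)

  LettersUpTo-normalForm : ∀ k i → LettersUpTo k (normalForm k i)
  LettersUpTo-normalForm zero i = LettersUpTo-pow (toℕ i) (LettersUpTo-x 0 z≤n)
  LettersUpTo-normalForm (suc k) i =
    ++⁺ (LettersUpTo-mono (n≤1+n k) (LettersUpTo-normalForm k (proj₁ (remQuot {normalCount k} (p (suc k)) i))))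
        (LettersUpTo-pow (toℕ (proj₂ (remQuot {normalCount k} (p (suc k)) i)))
                         (++⁺ (LettersUpTo-x k (n≤1+n k)) (LettersUpTo-x (suc k) ≤-refl)))

  Slides : ℕ → ℕ → Word → Set
  Slides K r v = Σ Word λ w → Σ ℕ λ s → LettersUpTo (K ∸ 1) w × (pow (y K) r ++ v ~ w ++ pow (y K) s)

  -- Moving x_j left past a power of y_{j+2} is the one rewriting step the Coxeter-type relators do not
  -- provide; it is where the hypothesis on p enters the upper bound.
  SlidePast : ℕ → Set
  SlidePast j = ∀ r → r < p (2 + j) → Slides (2 + j) r (x j)

  SlidePastBelow : ℕ → Set
  SlidePastBelow n = ∀ j → 2 + j ≤ n → SlidePast j

module Spanning (m : ℕ) (p : ℕ → ℕ) (p≥2 : ∀ K → 1 ≤ K → K ≤ m → 2 ≤ p K) where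
  open Presentation m p
  open Words m p
  open NormalForms m p

  y^p~[] : ∀ K → 1 ≤ K → K ≤ m → pow (y K) (p K) ~ []
  y^p~[] K 1≤K K≤m = relator~[] (rel-p K 1≤K K≤m)

  p>0 : ∀ K → 1 ≤ K → K ≤ m → 0 < p K
  p>0 K 1≤K K≤m = ≤-trans (s≤s z≤n) (p≥2 K 1≤K K≤m)

  reduce-pow : ∀ K → 1 ≤ K → K ≤ m → ∀ s → Σ (Fin (p K)) λ t → pow (y K) s ~ pow (y K) (toℕ t)
  reduce-pow K 1≤K K≤m s = fromℕ< (m%n<n s (p K)) , (
    pow (y K) s                                     ≡⟨ cong (pow (y K)) (m≡m%n+[m/n]*n s (p K)) ⟩
    pow (y K) (s % p K + (s / p K) * p K)           ≡⟨ pow-+ (y K) (s % p K) _ ⟩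
    pow (y K) (s % p K) ++ pow (y K) ((s / p K) * p K) ≡⟨ cong (pow (y K) (s % p K) ++_) (pow-* (y K) (s / p K) (p K)) ⟩
    pow (y K) (s % p K) ++ pow (pow (y K) (p K)) (s / p K) ~⟨ ++-congˡ _ (pow-~[] (s / p K) (y^p~[] K 1≤K K≤m)) ⟩
    pow (y K) (s % p K) ++ []                       ≡⟨ ++-identityʳ _ ⟩
    pow (y K) (s % p K)                             ≡⟨ cong (pow (y K)) (sym (toℕ-fromℕ< (m%n<n s (p K)))) ⟩
    pow (y K) (toℕ (fromℕ< (m%n<n s (p K))))        ∎)
    where instance _ = >-nonZero (p>0 K 1≤K K≤m)

  ≤suc-cases : ∀ {i k} → i ≤ suc k → i ≡ suc k ⊎ i ≡ k ⊎ suc i ≡ k ⊎ 2 + i ≤ k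
  ≤suc-cases {i} {k} i≤1+k with i ≟ suc k | i ≟ k | suc i ≟ k
  ... | yes e | _     | _     = inj₁ e
  ... | no _  | yes e | _     = inj₂ (inj₁ e)
  ... | no _  | no _  | yes e = inj₂ (inj₂ (inj₁ e))
  ... | no ≢1 | no ≢2 | no ≢3 = inj₂ (inj₂ (inj₂ (≤∧≢⇒< (≤∧≢⇒< (≤-pred (≤∧≢⇒< i≤1+k ≢1)) ≢2) ≢3)))

  slide-by : ∀ {k} c → suc (toℕ c) ≡ k → SlidePast (toℕ c) → ∀ r → r < p (suc k) → Slides (suc k) r (c ∷ [])
  slide-by c refl H r r<p = subst (Slides (2 + toℕ c) r) (x-toℕ c) (H r r<p)

  slide : ∀ k → suc k ≤ m → SlidePastBelow (suc k) → ∀ r → r < p (suc k) →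
          ∀ c → toℕ c ≤ suc k → Slides (suc k) r (c ∷ [])
  slide k k<m H r r<p c c≤1+k = by-cases (≤suc-cases c≤1+k)
    where
    k≤m = ≤-trans (n≤1+n k) k<m
    a = letter k k≤m
    b = letter (suc k) k<m
    open Dihedral m p a b
    a≤k : toℕ a ≤ k
    a≤k = ≤-reflexive (toℕ-letter k k≤m)
    y≡D : y (suc k) ≡ D
    y≡D = cong₂ _++_ (x≡letter k k≤m) (x≡letter (suc k) k<m)
    open OfOrder (p (suc k)) (p>0 (suc k) (s≤s z≤n) k<m)
                 (subst (λ Y → pow Y (p (suc k)) ~ []) y≡D (y^p~[] (suc k) (s≤s z≤n) k<m))
    via-D : ∀ {v} → (Σ Word λ w → Σ ℕ λ s → LettersUpTo k w × (pow D r ++ v ~ w ++ pow D s)) → Slides (suc k) r v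
    via-D {v} = subst (λ Y → Σ Word λ w → Σ ℕ λ s → LettersUpTo k w × (pow Y r ++ v ~ w ++ pow Y s)) (sym y≡D)

    by-cases : toℕ c ≡ suc k ⊎ toℕ c ≡ k ⊎ suc (toℕ c) ≡ k ⊎ 2 + toℕ c ≤ k → Slides (suc k) r (c ∷ [])
    by-cases (inj₁ c≡1+k) =
      subst (λ c → Slides (suc k) r (c ∷ [])) (sym (toℕ-injective (trans c≡1+k (sym (toℕ-letter (suc k) k<m)))))
      (via-D (a ∷ [] , r * (p (suc k) ∸ 1) + 1 , a≤k ∷ [] , D^r·b~a·D^s r))
    by-cases (inj₂ (inj₁ c≡k)) =
      subst (λ c → Slides (suc k) r (c ∷ [])) (sym (toℕ-injective (trans c≡k (sym (toℕ-letter k k≤m)))))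
      (via-D (a ∷ [] , r * (p (suc k) ∸ 1) , a≤k ∷ [] , D^r·a~a·D^s r))
    by-cases (inj₂ (inj₂ (inj₁ 1+c≡k))) = slide-by c 1+c≡k (H (toℕ c) (s≤s (≤-reflexive 1+c≡k))) r r<p
    by-cases (inj₂ (inj₂ (inj₂ 2+c≤k))) =
      via-D (c ∷ [] , r , m+n≤o⇒n≤o 2 2+c≤k ∷ [] ,
             D^r·c~c·D^r c (far-commute c a (far k k≤m 2+c≤k)) (far-commute c b (far (suc k) k<m (≤-trans 2+c≤k (n≤1+n k)))) r)
      where
      far : ∀ j (j≤m : j ≤ m) → 2 + toℕ c ≤ j → Far (toℕ c) (toℕ (letter j j≤m))
      far j j≤m 2+c≤j = inj₁ (subst (λ t → 2 ≤ t ∸ toℕ c) (sym (toℕ-letter j j≤m)) (m+n≤o⇒m≤o∸n 2 2+c≤j))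

  AppendLetter : ℕ → Set
  AppendLetter k = ∀ i c → toℕ c ≤ k → Σ (Fin (normalCount k)) λ i' → normalForm k i ++ c ∷ [] ~ normalForm k i'

  append-word : ∀ {k} → AppendLetter k →
                ∀ i w → LettersUpTo k w → Σ (Fin (normalCount k)) λ i' → normalForm k i ++ w ~ normalForm k i'
  append-word _ i [] [] = i , ≡⇒~ (++-identityʳ _)
  append-word {k} append i (c ∷ w) (c≤k ∷ w≤k) with append i c c≤k
  ... | i₁ , e₁ with append-word append i₁ w w≤k
  ...   | i₂ , e₂ = i₂ , (
    normalForm k i ++ c ∷ w          ≡⟨ sym (++-assoc (normalForm k i) (c ∷ []) w) ⟩
    (normalForm k i ++ c ∷ []) ++ w  ~⟨ ++-congʳ w e₁ ⟩
    normalForm k i₁ ++ w             ~⟨ e₂ ⟩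
    normalForm k i₂                  ∎)

  c∷[]≡x₀ : ∀ c → toℕ c ≤ 0 → c ∷ [] ≡ x 0
  c∷[]≡x₀ c c≤0 = trans (sym (x-toℕ c)) (cong x (n≤0⇒n≡0 c≤0))

  append-letter : ∀ k → k ≤ m → SlidePastBelow k → AppendLetter k
  append-to-y-pow : ∀ k → suc k ≤ m → SlidePastBelow (suc k) → ∀ q (t : Fin (p (suc k))) c → toℕ c ≤ suc k →
    Σ (Fin (normalCount (suc k))) λ i' → (normalForm k q ++ pow (y (suc k)) (toℕ t)) ++ c ∷ [] ~ normalForm (suc k) i'

  append-letter zero _ _ fzero c c≤0 = fsuc fzero , ≡⇒~ (trans (c∷[]≡x₀ c c≤0) (sym (++-identityʳ (x 0))))
  append-letter zero _ _ (fsuc fzero) c c≤0 = fzero , subst (λ w → (w ++ []) ++ c ∷ [] ~ []) (c∷[]≡x₀ c c≤0) (letter²~[] c)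
  append-letter (suc k) k<m H i c c≤1+k =
    append-to-y-pow k k<m H (proj₁ (remQuot {normalCount k} (p (suc k)) i)) (proj₂ (remQuot {normalCount k} (p (suc k)) i))
                    c c≤1+k

  append-to-y-pow k k<m H q t c c≤1+k with slide k k<m H (toℕ t) (toℕ<n t) c c≤1+k
  ... | w , s , w≤k , slid
    with append-word (append-letter k (≤-trans (n≤1+n k) k<m) (λ j le → H j (≤-trans le (n≤1+n k)))) q w w≤k
  ...   | q' , absorbed with reduce-pow (suc k) (s≤s z≤n) k<m s
  ...     | t' , reduced = combine q' t' , (
    (normalForm k q ++ Y^ (toℕ t)) ++ c ∷ [] ≡⟨ ++-assoc (normalForm k q) (Y^ (toℕ t)) (c ∷ []) ⟩
    normalForm k q ++ (Y^ (toℕ t) ++ c ∷ []) ~⟨ ++-congˡ (normalForm k q) slid ⟩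
    normalForm k q ++ (w ++ Y^ s)            ≡⟨ sym (++-assoc (normalForm k q) w (Y^ s)) ⟩
    (normalForm k q ++ w) ++ Y^ s            ~⟨ ++-cong absorbed reduced ⟩
    normalForm k q' ++ Y^ (toℕ t')           ≡⟨ sym (normalForm-combine k q' t') ⟩
    normalForm (suc k) (combine q' t')       ∎)
    where
    Y^ : ℕ → Word
    Y^ = pow (y (suc k))

  normalForm-[] : ∀ k → k ≤ m → Σ (Fin (normalCount k)) λ i → normalForm k i ≡ []
  normalForm-[] zero _ = fzero , refl
  normalForm-[] (suc k) k<m with normalForm-[] k (≤-trans (n≤1+n k) k<m)
  ... | i , nf≡[] = combine i (fromℕ< 0<p) ,
    trans (normalForm-combine k i _) (cong₂ _++_ nf≡[] (cong (pow (y (suc k))) (toℕ-fromℕ< 0<p)))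
    where
    0<p : 0 < p (suc k)
    0<p = p>0 (suc k) (s≤s z≤n) k<m

  normalForm-surjective : SlidePastBelow m → ∀ w → Σ (Fin (normalCount m)) λ i → w ~ normalForm m i
  normalForm-surjective H w with normalForm-[] m ≤-refl
  ... | i₀ , nf≡[] with append-word (append-letter m ≤-refl H) i₀ w (LettersUpTo-m w)
  ...   | i , e = i , subst (λ u → u ++ w ~ normalForm m i) nf≡[] e

-- Separating actions: normal forms are pairwise distinct

module Actions (m : ℕ) (p : ℕ → ℕ) where
  open Presentation m p
  open Words m p
  open NormalForms m p

  -- Words act on the right: the letters of a word are applied from left to right.
  act* : {P : Set} → (Fin (suc m) → P → P) → Word → P → P
  act* f [] z = z
  act* f (c ∷ w) z = act* f w (f c z)

  act*-++ : ∀ {P : Set} (f : Fin (suc m) → P → P) u v z → act* f (u ++ v) z ≡ act* f v (act* f u z)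
  act*-++ f [] v z = refl
  act*-++ f (c ∷ u) v z = act*-++ f u v (f c z)

  record Action : Set₁ where
    field
      points : Setoid 0ℓ 0ℓ
    open Setoid points public using (Carrier; _≈_) renaming (refl to ≈-refl; sym to ≈-sym; trans to ≈-trans)
    field
      act : Fin (suc m) → Carrier → Carrier
      act-cong : ∀ c {z z'} → z ≈ z' → act c z ≈ act c z'
      relator-fixes : ∀ {ρ} → IsRelator ρ → ∀ z → act* act ρ z ≈ z

    actW : Word → Carrier → Carrier
    actW = act* act

    actW-cong : ∀ w {z z'} → z ≈ z' → actW w z ≈ actW w z'
    actW-cong [] e = e
    actW-cong (c ∷ w) e = actW-cong w (act-cong c e)

    ~⇒actW≈ : ∀ {u v} → u ~ v → ∀ z → actW u z ≈ actW v z
    ~⇒actW≈ ~refl z = ≈-refl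
    ~⇒actW≈ (~sym e) z = ≈-sym (~⇒actW≈ e z)
    ~⇒actW≈ (~trans e f) z = ≈-trans (~⇒actW≈ e z) (~⇒actW≈ f z)
    ~⇒actW≈ (~ins {ρ} r u v) z =
      subst₂ _≈_ (sym (act*-++ act u v z)) (sym (trans (act*-++ act u (ρ ++ v) z) (act*-++ act ρ v _)))
        (actW-cong v (≈-sym (relator-fixes r (actW u z))))

  record Separates (K : ℕ) : Set₁ where
    field
      action : Action
    open Action action public
    field
      base : Carrier
      fixed-below : ∀ c → toℕ c < K → act c base ≈ base
      y-orbit-injective : ∀ a b → a < p K → b < p K → actW (pow (y K) a) base ≈ actW (pow (y K) b) base → a ≡ b

  parity≥ : ℕ → Word → Bool
  parity≥ K [] = false
  parity≥ K (c ∷ w) = does (K ≤? toℕ c) xor parity≥ K w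

  parity≥-++ : ∀ K u v → parity≥ K (u ++ v) ≡ parity≥ K u xor parity≥ K v
  parity≥-++ K [] v = refl
  parity≥-++ K (c ∷ u) v =
    trans (cong (does (K ≤? toℕ c) xor_) (parity≥-++ K u v)) (sym (xor-assoc (does (K ≤? toℕ c)) (parity≥ K u) (parity≥ K v)))

  parity≥-square : ∀ K w → parity≥ K (pow w 2) ≡ false
  parity≥-square K w =
    trans (parity≥-++ K w (w ++ []))
      (trans (cong (parity≥ K w xor_) (trans (parity≥-++ K w []) (xor-identityʳ (parity≥ K w)))) (xor-same (parity≥ K w)))

  parity≥-pow : ∀ K w n → parity≥ K w ≡ false → parity≥ K (pow w n) ≡ false
  parity≥-pow K w zero _ = refl
  parity≥-pow K w (suc n) even = trans (parity≥-++ K w (pow w n)) (cong₂ _xor_ even (parity≥-pow K w n even))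

  parity≥-x : ∀ K j → j ≤ m → parity≥ K (x j) ≡ does (K ≤? j)
  parity≥-x K j j≤m rewrite x≡letter j j≤m | toℕ-letter j j≤m = xor-identityʳ _

  ≤?-pred : ∀ K j → 1 ≤ j → j ≢ K → does (K ≤? j ∸ 1) ≡ does (K ≤? j)
  ≤?-pred K (suc J) _ 1+J≢K with K ≤? J
  ... | yes K≤J = trans (dec-true (K ≤? J) K≤J) (sym (dec-true (K ≤? suc J) (m≤n⇒m≤1+n K≤J)))
  ... | no K≰J = trans (dec-false (K ≤? J) K≰J)
                   (sym (dec-false (K ≤? suc J) λ K≤1+J → 1+J≢K (≤-antisym (≰⇒> K≰J) K≤1+J)))

  parity≥-relator : ∀ K → (1 ≤ K → K ≤ m → p K ≡ 2) → ∀ {ρ} → IsRelator ρ → parity≥ K ρ ≡ false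
  parity≥-relator K _ (rel-inv j _) = parity≥-square K (x j)
  parity≥-relator K _ (rel-comm j k _ _ _) = parity≥-square K (x j ++ x k)
  parity≥-relator K _ (rel-r j _ _) rewrite r≡pow j =
    parity≥-square K (xs (r-indices j (does (2 ∣? p j)) (does (2 ∣? p (suc j)))))
  parity≥-relator K pK≡2 (rel-p j 1≤j j≤m) with j ≟ K
  ... | yes refl rewrite pK≡2 1≤j j≤m = parity≥-square K (y K)
  ... | no j≢K = parity≥-pow K (y j) (p j) (trans (parity≥-++ K (x (j ∸ 1)) (x j))
      (trans (cong₂ _xor_ (parity≥-x K (j ∸ 1) (≤-trans (m∸n≤m j 1) j≤m)) (parity≥-x K j j≤m))
             (trans (cong (_xor does (K ≤? j)) (≤?-pred K j 1≤j j≢K)) (xor-same (does (K ≤? j))))))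

  act*-xor : ∀ K w b → act* (λ c → does (K ≤? toℕ c) xor_) w b ≡ parity≥ K w xor b
  act*-xor K [] b = refl
  act*-xor K (c ∷ w) b = trans (act*-xor K w _)
    (trans (sym (xor-assoc (parity≥ K w) (does (K ≤? toℕ c)) b)) (cong (_xor b) (xor-comm (parity≥ K w) (does (K ≤? toℕ c)))))

  parityAction : ∀ K → (1 ≤ K → K ≤ m → p K ≡ 2) → Action
  parityAction K pK≡2 = record
    { points = setoid Bool
    ; act = λ c → does (K ≤? toℕ c) xor_
    ; act-cong = λ c → cong (does (K ≤? toℕ c) xor_)
    ; relator-fixes = λ {ρ} r b → trans (act*-xor K ρ b) (cong (_xor b) (parity≥-relator K pK≡2 r))
    }

  parity-separates : ∀ K → 1 ≤ K → K ≤ m → p K ≡ 2 → Separates K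
  parity-separates K 1≤K K≤m pK≡2 = record
    { action = parityAction K (λ _ _ → pK≡2)
    ; base = false
    ; fixed-below = λ c c<K → trans (xor-identityʳ _) (dec-false (K ≤? toℕ c) (<⇒≱ c<K))
    ; y-orbit-injective = λ a b a<p b<p → orbit-injective a b (subst (a <_) pK≡2 a<p) (subst (b <_) pK≡2 b<p)
    }
    where
    flip : Fin (suc m) → Bool → Bool
    flip c = does (K ≤? toℕ c) xor_
    y-flips : act* flip (pow (y K) 1) false ≡ true
    y-flips = trans (act*-xor K (y K ++ []) false) (trans (xor-identityʳ _)
      (trans (trans (parity≥-++ K (y K) []) (xor-identityʳ _)) (trans (parity≥-++ K (x (K ∸ 1)) (x K))
      (cong₂ _xor_ (trans (parity≥-x K (K ∸ 1) (≤-trans (m∸n≤m K 1) K≤m)) (dec-false (K ≤? K ∸ 1) K≰K-1))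
                   (trans (parity≥-x K K K≤m) (dec-true (K ≤? K) ≤-refl))))))
      where
      K≰K-1 = <⇒≱ (∸-monoʳ-< {K} {1} {0} (s≤s z≤n) 1≤K)
    false≢true : false ≢ true
    false≢true ()
    orbit-injective : ∀ a b → a < 2 → b < 2 → act* flip (pow (y K) a) false ≡ act* flip (pow (y K) b) false → a ≡ b
    orbit-injective 0 0 _ _ _ = refl
    orbit-injective 1 1 _ _ _ = refl
    orbit-injective 0 1 _ _ e = ⊥-elim (false≢true (trans e y-flips))
    orbit-injective 1 0 _ _ e = ⊥-elim (false≢true (trans (sym e) y-flips))
    orbit-injective (suc (suc _)) _ (s≤s (s≤s ())) _ _
    orbit-injective _ (suc (suc _)) _ (s≤s (s≤s ())) _

  x₀≁[] : ¬ (x 0 ++ [] ~ [])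
  x₀≁[] x₀~[] with Action.~⇒actW≈ (parityAction 0 λ ()) x₀~[] true
  ... | ()

  normalForm₀-injective : ∀ i i' → normalForm 0 i ~ normalForm 0 i' → i ≡ i'
  normalForm₀-injective fzero fzero _ = refl
  normalForm₀-injective fzero (fsuc fzero) e = ⊥-elim (x₀≁[] (~sym e))
  normalForm₀-injective (fsuc fzero) fzero e = ⊥-elim (x₀≁[] e)
  normalForm₀-injective (fsuc fzero) (fsuc fzero) _ = refl

  module _ (separates : ∀ K → 1 ≤ K → K ≤ m → Separates K) where

    normalForm-injective : ∀ k → k ≤ m → ∀ i i' → normalForm k i ~ normalForm k i' → i ≡ i'
    normalForm-injective zero _ = normalForm₀-injective
    normalForm-injective (suc k) k<m i i' e =
      trans (sym (combine-remQuot {normalCount k} (p (suc k)) i))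
        (trans (cong₂ combine q≡q' t≡t') (combine-remQuot {normalCount k} (p (suc k)) i'))
      where
      q = proj₁ (remQuot {normalCount k} (p (suc k)) i)
      t = proj₂ (remQuot {normalCount k} (p (suc k)) i)
      q' = proj₁ (remQuot {normalCount k} (p (suc k)) i')
      t' = proj₂ (remQuot {normalCount k} (p (suc k)) i')
      Y^ : ℕ → Word
      Y^ = pow (y (suc k))
      open Separates (separates (suc k) (s≤s z≤n) k<m)
      fixes : ∀ w → LettersUpTo k w → actW w base ≈ base
      fixes [] _ = ≈-refl
      fixes (c ∷ w) (c≤k ∷ w≤k) = ≈-trans (actW-cong w (fixed-below c (s≤s c≤k))) (fixes w w≤k)
      -- the normal-form prefix fixes the base point, so the action only sees the exponent of y_{k+1}
      orbit : ∀ q r → actW (normalForm k q ++ Y^ r) base ≈ actW (Y^ r) base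
      orbit q r = subst (_≈ actW (Y^ r) base) (sym (act*-++ act (normalForm k q) (Y^ r) base))
                    (actW-cong (Y^ r) (fixes (normalForm k q) (LettersUpTo-normalForm k q)))
      t≡t' : t ≡ t'
      t≡t' = toℕ-injective (y-orbit-injective _ _ (toℕ<n t) (toℕ<n t')
               (≈-trans (≈-sym (orbit q (toℕ t))) (≈-trans (~⇒actW≈ e base) (orbit q' (toℕ t')))))
      q≡q' : q ≡ q'
      q≡q' = normalForm-injective k (≤-trans (n≤1+n k) k<m) q q'
               (++-cancelʳ _ _ (Y^ (toℕ t))
                 (subst (λ s → normalForm k q ++ Y^ (toℕ t) ~ normalForm k q' ++ Y^ (toℕ s)) (sym t≡t') e))

    y-hasOrder : (∀ K → 1 ≤ K → K ≤ m → 2 ≤ p K) → ∀ K → 1 ≤ K → K ≤ m → HasOrder (y K) (p K)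
    y-hasOrder p≥2 K 1≤K K≤m = ≤-trans (s≤s z≤n) (p≥2 K 1≤K K≤m) , relator~[] (rel-p K 1≤K K≤m) , no-smaller
      where
      open Separates (separates K 1≤K K≤m)
      no-smaller : ∀ j → 1 ≤ j → j < p K → ¬ (pow (y K) j ~ [])
      no-smaller (suc j) _ j<p y^j~[] with y-orbit-injective (suc j) 0 j<p (≤-trans (s≤s z≤n) j<p) (~⇒actW≈ y^j~[] base)
      ... | ()

-- Affine actions on ℤ/N

-- (true , c) is the translation z ↦ z + c and (false , c) the reflection z ↦ c − z.
Aff : Set
Aff = Bool × ℤ

apply : Aff → ℤ → ℤ
apply (true , c) z = z +ℤ c
apply (false , c) z = c -ℤ z

infixl 7 _⨾_
_⨾_ : Aff → Aff → Aff
(true , c) ⨾ (true , d) = true , c +ℤ d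
(true , c) ⨾ (false , d) = false , d -ℤ c
(false , c) ⨾ (true , d) = false , c +ℤ d
(false , c) ⨾ (false , d) = true , d -ℤ c

apply-⨾ : ∀ f g z → apply (f ⨾ g) z ≡ apply g (apply f z)
apply-⨾ (true , c) (true , d) z = lemma c d z
  where lemma : ∀ (c d z : ℤ) → z +ℤ (c +ℤ d) ≡ (z +ℤ c) +ℤ d
        lemma = solve-∀
apply-⨾ (true , c) (false , d) z = lemma c d z
  where lemma : ∀ (c d z : ℤ) → (d -ℤ c) -ℤ z ≡ d -ℤ (z +ℤ c)
        lemma = solve-∀
apply-⨾ (false , c) (true , d) z = lemma c d z
  where lemma : ∀ (c d z : ℤ) → (c +ℤ d) -ℤ z ≡ (c -ℤ z) +ℤ d
        lemma = solve-∀
apply-⨾ (false , c) (false , d) z = lemma c d z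
  where lemma : ∀ (c d z : ℤ) → z +ℤ (d -ℤ c) ≡ d -ℤ (c -ℤ z)
        lemma = solve-∀

idᵃ : Aff
idᵃ = true , + 0

infixr 8 _^ᵃ_
_^ᵃ_ : Aff → ℕ → Aff
f ^ᵃ zero = idᵃ
f ^ᵃ suc n = f ⨾ f ^ᵃ n

infix 4 _≐_
_≐_ : Aff → Aff → Set
f ≐ g = ∀ z → apply f z ≡ apply g z

⨾-cong : ∀ {f f' g g'} → f ≐ f' → g ≐ g' → f ⨾ g ≐ f' ⨾ g'
⨾-cong {f} {f'} {g} {g'} f≐f' g≐g' z =
  trans (apply-⨾ f g z) (trans (cong (apply g) (f≐f' z)) (trans (g≐g' _) (sym (apply-⨾ f' g' z))))

⨾-congˡ : ∀ f {g g'} → g ≐ g' → f ⨾ g ≐ f ⨾ g'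
⨾-congˡ f = ⨾-cong {f} {f} (λ _ → refl)

⨾-assoc : ∀ f g h → (f ⨾ g) ⨾ h ≐ f ⨾ (g ⨾ h)
⨾-assoc f g h z = trans (apply-⨾ (f ⨾ g) h z) (trans (cong (apply h) (apply-⨾ f g z))
  (trans (sym (apply-⨾ g h _)) (sym (apply-⨾ f (g ⨾ h) z))))

⨾-identityˡ : ∀ f → idᵃ ⨾ f ≐ f
⨾-identityˡ f z = trans (apply-⨾ idᵃ f z) (cong (apply f) (ℤ.+-identityʳ z))

⨾-identityʳ : ∀ f → f ⨾ idᵃ ≐ f
⨾-identityʳ f z = trans (apply-⨾ f idᵃ z) (ℤ.+-identityʳ _)

^ᵃ-+ : ∀ f a b → f ^ᵃ (a + b) ≐ f ^ᵃ a ⨾ f ^ᵃ b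
^ᵃ-+ f zero b z = sym (⨾-identityˡ (f ^ᵃ b) z)
^ᵃ-+ f (suc a) b z = trans (⨾-congˡ f (^ᵃ-+ f a b) z) (sym (⨾-assoc f (f ^ᵃ a) (f ^ᵃ b) z))

^ᵃ-cong : ∀ {f g} n → f ≐ g → f ^ᵃ n ≐ g ^ᵃ n
^ᵃ-cong zero _ z = refl
^ᵃ-cong {f} {g} (suc n) f≐g = ⨾-cong {f} {g} {f ^ᵃ n} {g ^ᵃ n} f≐g (^ᵃ-cong n f≐g)

^ᵃ-* : ∀ f a b → f ^ᵃ (a * b) ≐ (f ^ᵃ b) ^ᵃ a
^ᵃ-* f zero b z = refl
^ᵃ-* f (suc a) b z = trans (^ᵃ-+ f b (a * b) z) (⨾-congˡ (f ^ᵃ b) (^ᵃ-* f a b) z)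

idᵃ-^ : ∀ n → idᵃ ^ᵃ n ≐ idᵃ
idᵃ-^ zero z = refl
idᵃ-^ (suc n) z = trans (apply-⨾ idᵃ (idᵃ ^ᵃ n) z) (trans (idᵃ-^ n _) (ℤ.+-identityʳ _))

reflection-^2 : ∀ c → (false , c) ^ᵃ 2 ≐ idᵃ
reflection-^2 c z = lemma c z
  where lemma : ∀ c z → z +ℤ ((c +ℤ + 0) -ℤ c) ≡ z +ℤ + 0
        lemma = solve-∀

reflection-^even : ∀ c k → (false , c) ^ᵃ (k * 2) ≐ idᵃ
reflection-^even c k z = trans (^ᵃ-* (false , c) k 2 z) (trans (^ᵃ-cong k (reflection-^2 c) z) (idᵃ-^ k z))

translation-^ : ∀ c n → (true , c) ^ᵃ n ≐ (true , + n *ℤ c)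
translation-^ c zero z = cong (z +ℤ_) (sym (ℤ.*-zeroˡ c))
translation-^ c (suc n) z = trans (apply-⨾ (true , c) ((true , c) ^ᵃ n) z) (trans (translation-^ c n _) (lemma (+ n) c z))
  where lemma : ∀ n c z → (z +ℤ c) +ℤ n *ℤ c ≡ z +ℤ (+ 1 +ℤ n) *ℤ c
        lemma = solve-∀

shift-^-from-0 : ∀ a → apply ((true , + 1) ^ᵃ a) (+ 0) ≡ + a
shift-^-from-0 a = trans (translation-^ (+ 1) a (+ 0)) (trans (ℤ.+-identityˡ _) (ℤ.*-identityʳ (+ a)))

reflection-involutive : ∀ c z → apply (false , c) (apply (false , c) z) ≡ z
reflection-involutive c z = lemma c z
  where lemma : ∀ c z → c -ℤ (c -ℤ z) ≡ z
        lemma = solve-∀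

infix 4 _≡[_]_
record _≡[_]_ (z : ℤ) (N : ℕ) (z' : ℤ) : Set where
  constructor mod
  field
    N∣z-z' : + N ∣ℤ z -ℤ z'

≡⇒≡[] : ∀ {N z z'} → z ≡ z' → z ≡[ N ] z'
≡⇒≡[] {N} {z} refl = mod (dividesℤ (+ 0) (ℤ.+-inverseʳ z))

≡[]-refl : ∀ {N z} → z ≡[ N ] z
≡[]-refl = ≡⇒≡[] refl

≡[]-sym : ∀ {N z z'} → z ≡[ N ] z' → z' ≡[ N ] z
≡[]-sym {N} {z} {z'} (mod N∣z-z') = mod (subst (+ N ∣ℤ_) (lemma z z') (∣m⇒∣-m N∣z-z'))
  where lemma : ∀ z z' → -ℤ (z -ℤ z') ≡ z' -ℤ z
        lemma = solve-∀

≡[]-trans : ∀ {N z z' z''} → z ≡[ N ] z' → z' ≡[ N ] z'' → z ≡[ N ] z''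
≡[]-trans {N} {z} {z'} {z''} (mod e) (mod e') = mod (subst (+ N ∣ℤ_) (lemma z z' z'') (∣m∣n⇒∣m+n e e'))
  where lemma : ∀ z z' z'' → (z -ℤ z') +ℤ (z' -ℤ z'') ≡ z -ℤ z''
        lemma = solve-∀

ℤ-mod : ℕ → Setoid 0ℓ 0ℓ
ℤ-mod N = record
  { Carrier = ℤ ; _≈_ = _≡[ N ]_
  ; isEquivalence = record { refl = ≡[]-refl ; sym = ≡[]-sym ; trans = ≡[]-trans } }

≡[]⇒≡ : ∀ {N a b} → a < N → b < N → + a ≡[ N ] + b → a ≡ b
≡[]⇒≡ {N} {a} {b} a<N b<N (mod N∣a-b) = ℤ.+-injective (ℤ.i-j≡0⇒i≡j (+ a) (+ b) (ℤ.∣i∣≡0⇒i≡0 ∣a-b∣≡0))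
  where
  instance _ = >-nonZero (≤-trans (s≤s z≤n) a<N)
  ∣a-b∣<N : ∣ + a -ℤ + b ∣ < N
  ∣a-b∣<N = subst (_< N) (cong ∣_∣ (sym (ℤ.[+m]-[+n]≡m⊖n a b))) (≤-<-trans (ℤ.∣m⊝n∣≤m⊔n a b) (⊔-lub a<N b<N))
  ∣a-b∣≡0 : ∣ + a -ℤ + b ∣ ≡ 0
  ∣a-b∣≡0 = trans (sym (m<n⇒m%n≡m ∣a-b∣<N)) (n∣m⇒m%n≡0 _ N (∣⇒∣ᵤ N∣a-b))

apply-cong : ∀ {N} f {z z'} → z ≡[ N ] z' → apply f z ≡[ N ] apply f z'
apply-cong {N} (true , c) {z} {z'} (mod e) = mod (subst (+ N ∣ℤ_) (lemma c z z') e)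
  where lemma : ∀ c z z' → z -ℤ z' ≡ (z +ℤ c) -ℤ (z' +ℤ c)
        lemma = solve-∀
apply-cong {N} (false , c) {z} {z'} (mod e) = mod (subst (+ N ∣ℤ_) (lemma c z z') (∣m⇒∣-m e))
  where lemma : ∀ c z z' → -ℤ (z -ℤ z') ≡ (c -ℤ z) -ℤ (c -ℤ z')
        lemma = solve-∀

record IsIdMod (N : ℕ) (f : Aff) : Set where
  constructor isIdMod
  field
    apply≡[]id : ∀ z → apply f z ≡[ N ] z

IsIdMod-≐ : ∀ {N f g} → f ≐ g → IsIdMod N g → IsIdMod N f
IsIdMod-≐ f≐g (isIdMod g≡id) = isIdMod λ z → ≡[]-trans (≡⇒≡[] (f≐g z)) (g≡id z)

≡idᵃ⇒IsIdMod : ∀ {N f} → f ≡ idᵃ → IsIdMod N f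
≡idᵃ⇒IsIdMod refl = isIdMod λ z → ≡⇒≡[] (ℤ.+-identityʳ z)

translation-IsIdMod : ∀ N c t → c ≡ t *ℤ + N → IsIdMod N (true , c)
translation-IsIdMod N c t c≡tN = isIdMod λ z → mod (dividesℤ t (trans (lemma z c) c≡tN))
  where lemma : ∀ z c → (z +ℤ c) -ℤ z ≡ c
        lemma = solve-∀

translation-^-IsIdMod : ∀ N c n t → + n *ℤ c ≡ t *ℤ + N → IsIdMod N ((true , c) ^ᵃ n)
translation-^-IsIdMod N c n t e = IsIdMod-≐ (translation-^ c n) (translation-IsIdMod N (+ n *ℤ c) t e)

shift-^-IsIdMod : ∀ N → IsIdMod N ((true , + 1) ^ᵃ N)
shift-^-IsIdMod N = translation-^-IsIdMod N (+ 1) N (+ 1) (ℤ.*-comm (+ N) (+ 1))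

reflection-^even-IsIdMod : ∀ {N} c n → 2 ∣ n → IsIdMod N ((false , c) ^ᵃ n)
reflection-^even-IsIdMod c n (divides k refl) = IsIdMod-≐ (reflection-^even c k) (≡idᵃ⇒IsIdMod refl)

reflection-^2-IsIdMod : ∀ {N} f → proj₁ f ≡ false → IsIdMod N (f ^ᵃ 2)
reflection-^2-IsIdMod (false , c) refl = IsIdMod-≐ (reflection-^2 c) (≡idᵃ⇒IsIdMod refl)

idᵃ-^-IsIdMod : ∀ {N} n → IsIdMod N (idᵃ ^ᵃ n)
idᵃ-^-IsIdMod n = IsIdMod-≐ (idᵃ-^ n) (≡idᵃ⇒IsIdMod refl)

r-image : Aff → Aff → Aff → Bool → Bool → Aff
r-image f g h true  true  = f ⨾ (g ⨾ (h ⨾ g))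
r-image f g h false true  = f ⨾ (g ⨾ (h ⨾ (g ⨾ h)))
r-image f g h true  false = h ⨾ (g ⨾ (f ⨾ (g ⨾ f)))
r-image f g h false false = idᵃ

module AffineActions (m : ℕ) (p : ℕ → ℕ) (N : ℕ) (τ : ℕ → Aff) where
  open Presentation m p
  open Words m p
  open Actions m p

  affW : Word → Aff
  affW [] = idᵃ
  affW (c ∷ w) = τ (toℕ c) ⨾ affW w

  τs : List ℕ → Aff
  τs [] = idᵃ
  τs (j ∷ []) = τ j
  τs (j ∷ k ∷ js) = τ j ⨾ τs (k ∷ js)

  act*≡apply-affW : ∀ w z → act* (λ c → apply (τ (toℕ c))) w z ≡ apply (affW w) z
  act*≡apply-affW [] z = sym (ℤ.+-identityʳ z)
  act*≡apply-affW (c ∷ w) z = trans (act*≡apply-affW w _) (sym (apply-⨾ (τ (toℕ c)) (affW w) z))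

  affW-++ : ∀ u v → affW (u ++ v) ≐ affW u ⨾ affW v
  affW-++ [] v z = sym (⨾-identityˡ (affW v) z)
  affW-++ (c ∷ u) v z = trans (⨾-congˡ (τ (toℕ c)) (affW-++ u v) z) (sym (⨾-assoc (τ (toℕ c)) (affW u) (affW v) z))

  affW-x : ∀ j → j ≤ m → affW (x j) ≐ τ j
  affW-x j j≤m z rewrite x≡letter j j≤m | toℕ-letter j j≤m = ⨾-identityʳ (τ j) z

  affW-xs : ∀ js → All (_≤ m) js → affW (xs js) ≐ τs js
  affW-xs [] _ z = refl
  affW-xs (j ∷ []) (j≤m ∷ _) = affW-x j j≤m
  affW-xs (j ∷ k ∷ js) (j≤m ∷ ks≤m) z =
    trans (affW-++ (x j) (xs (k ∷ js)) z) (⨾-cong {affW (x j)} {τ j} (affW-x j j≤m) (affW-xs (k ∷ js) ks≤m) z)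

  affW-pow : ∀ w n → affW (pow w n) ≐ affW w ^ᵃ n
  affW-pow w zero z = refl
  affW-pow w (suc n) z = trans (affW-++ w (pow w n) z) (⨾-congˡ (affW w) (affW-pow w n) z)

  affW-xs-pow : ∀ js n → All (_≤ m) js → affW (pow (xs js) n) ≐ τs js ^ᵃ n
  affW-xs-pow js n js≤m z = trans (affW-pow (xs js) n z) (^ᵃ-cong n (affW-xs js js≤m) z)

  τs-r-indices : ∀ j b₁ b₂ → τs (r-indices j b₁ b₂) ≡ r-image (τ (j ∸ 1)) (τ j) (τ (suc j)) b₁ b₂
  τs-r-indices j true  true  = refl
  τs-r-indices j false true  = refl
  τs-r-indices j true  false = refl
  τs-r-indices j false false = refl

  module _ (inv  : ∀ j → j ≤ m → IsIdMod N (τ j ^ᵃ 2))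
           (pow-p : ∀ j → 1 ≤ j → j ≤ m → IsIdMod N ((τ (j ∸ 1) ⨾ τ j) ^ᵃ p j))
           (comm : ∀ j k → j ≤ m → k ≤ m → Far j k → IsIdMod N ((τ j ⨾ τ k) ^ᵃ 2))
           (braid : ∀ j → 1 ≤ j → suc j ≤ m →
                    IsIdMod N (τs (r-indices j (does (2 ∣? p j)) (does (2 ∣? p (suc j)))) ^ᵃ 2)) where

    relator-IsIdMod : ∀ {ρ} → IsRelator ρ → IsIdMod N (affW ρ)
    relator-IsIdMod (rel-inv j j≤m) = IsIdMod-≐ (affW-xs-pow (j ∷ []) 2 (j≤m ∷ [])) (inv j j≤m)
    relator-IsIdMod (rel-p j 1≤j j≤m) =
      IsIdMod-≐ (affW-xs-pow (j ∸ 1 ∷ j ∷ []) (p j) (≤-trans (m∸n≤m j 1) j≤m ∷ j≤m ∷ [])) (pow-p j 1≤j j≤m)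
    relator-IsIdMod (rel-comm j k j≤m k≤m far) = IsIdMod-≐ (affW-xs-pow (j ∷ k ∷ []) 2 (j≤m ∷ k≤m ∷ [])) (comm j k j≤m k≤m far)
    relator-IsIdMod (rel-r j 1≤j j+2≤n) = subst (λ w → IsIdMod N (affW w)) (sym (r≡pow j))
      (IsIdMod-≐ (affW-xs-pow (r-indices j b₁ b₂) 2 (indices≤m b₁ b₂)) (braid j 1≤j j<m))
      where
      b₁ = does (2 ∣? p j)
      b₂ = does (2 ∣? p (suc j))
      j<m : suc j ≤ m
      j<m = ≤-pred (subst (_≤ suc m) (+-comm j 2) j+2≤n)
      j≤m = ≤-trans (n≤1+n j) j<m
      j-1≤m = ≤-trans (m∸n≤m j 1) j≤m
      indices≤m : ∀ b₁ b₂ → All (_≤ m) (r-indices j b₁ b₂)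
      indices≤m true  true  = j-1≤m ∷ j≤m ∷ j<m ∷ j≤m ∷ []
      indices≤m false true  = j-1≤m ∷ j≤m ∷ j<m ∷ j≤m ∷ j<m ∷ []
      indices≤m true  false = j<m ∷ j≤m ∷ j-1≤m ∷ j≤m ∷ j-1≤m ∷ []
      indices≤m false false = []

    action : Action
    action = record
      { points = ℤ-mod N
      ; act = λ c → apply (τ (toℕ c))
      ; act-cong = λ c → apply-cong (τ (toℕ c))
      ; relator-fixes = λ {ρ} r z →
          ≡[]-trans (≡⇒≡[] (act*≡apply-affW ρ z)) (IsIdMod.apply≡[]id (relator-IsIdMod r) z)
      }

    separates : ∀ K → 1 ≤ K → K ≤ m → N ≡ p K →
                (∀ j → j < K → apply (τ j) (+ 0) ≡ + 0) →
                (∀ a → a < p K → apply ((τ (K ∸ 1) ⨾ τ K) ^ᵃ a) (+ 0) ≡ + a) → Separates K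
    separates K 1≤K K≤m N≡pK fixes orbit = record
      { action = action
      ; base = + 0
      ; fixed-below = λ c c<K → ≡⇒≡[] (fixes (toℕ c) c<K)
      ; y-orbit-injective = λ a b a<p b<p e →
          ≡[]⇒≡ a<p b<p (subst (+ a ≡[_] + b) N≡pK
            (≡[]-trans (≡⇒≡[] (sym (y^a·0 a a<p))) (≡[]-trans e (≡⇒≡[] (y^a·0 b b<p)))))
      }
      where
      y^a·0 : ∀ a → a < p K → act* (λ c → apply (τ (toℕ c))) (pow (y K) a) (+ 0) ≡ + a
      y^a·0 a a<p = trans (act*≡apply-affW (pow (y K) a) (+ 0))
        (trans (affW-xs-pow (K ∸ 1 ∷ K ∷ []) a (≤-trans (m∸n≤m K 1) K≤m ∷ K≤m ∷ []) (+ 0)) (orbit a a<p))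

data Role : Set where
  fixed flip₀ flip₁ : Role

-- flip₀ is z ↦ −z and flip₁ is z ↦ 1 − z, so flip₀ followed by flip₁ is z ↦ z + 1.
⟦_⟧ : Role → Aff
⟦ fixed ⟧ = idᵃ
⟦ flip₀ ⟧ = false , + 0
⟦ flip₁ ⟧ = false , + 1

role : ℕ → ℕ → Role
role K j with j ≟ K
... | yes _ = flip₁
... | no _ with suc j ≟ K
...   | yes _ = flip₀
...   | no _ = fixed

role-K : ∀ K → role K K ≡ flip₁
role-K K with K ≟ K
... | yes _ = refl
... | no K≢K = ⊥-elim (K≢K refl)

role-pred : ∀ j → role (suc j) j ≡ flip₀
role-pred j with j ≟ suc j
... | yes j≡1+j = ⊥-elim (1+n≢n (sym j≡1+j))
... | no _ with suc j ≟ suc j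
...   | yes _ = refl
...   | no ≢ = ⊥-elim (≢ refl)

role-of-pred : ∀ {K j} → suc j ≡ K → role K j ≡ flip₀
role-of-pred {j = j} refl = role-pred j

role-fixed : ∀ K j → j ≢ K → suc j ≢ K → role K j ≡ fixed
role-fixed K j j≢K 1+j≢K with j ≟ K
... | yes j≡K = ⊥-elim (j≢K j≡K)
... | no _ with suc j ≟ K
...   | yes 1+j≡K = ⊥-elim (1+j≢K 1+j≡K)
...   | no _ = refl

Near : ℕ → ℕ → Set
Near K j = j ≡ K ⊎ suc j ≡ K

role-cases : ∀ K j → role K j ≡ fixed ⊎ Near K j
role-cases K j with j ≟ K
... | yes j≡K = inj₂ (inj₁ j≡K)
... | no _ with suc j ≟ K
...   | yes 1+j≡K = inj₂ (inj₂ 1+j≡K)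
...   | no _ = inj₁ refl

Near-¬Far : ∀ {K j k} → Near K j → Near K k → ¬ Far j k
Near-¬Far {K} (inj₁ refl) (inj₁ refl) = ¬Far-self K
Near-¬Far {k = k} (inj₁ refl) (inj₂ refl) = ¬Far-suc k
Near-¬Far {j = j} (inj₂ refl) (inj₁ refl) = ¬Far-suc j ∘ Far-sym {j} {suc j}
Near-¬Far {j = j} (inj₂ refl) (inj₂ e) rewrite suc-injective e = ¬Far-self j

module _ {N : ℕ} where

  ⟦⟧-square : ∀ t → IsIdMod N (⟦ t ⟧ ^ᵃ 2)
  ⟦⟧-square fixed = ≡idᵃ⇒IsIdMod refl
  ⟦⟧-square flip₀ = ≡idᵃ⇒IsIdMod refl
  ⟦⟧-square flip₁ = ≡idᵃ⇒IsIdMod refl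

  fixed-commutesˡ : ∀ t → IsIdMod N ((⟦ fixed ⟧ ⨾ ⟦ t ⟧) ^ᵃ 2)
  fixed-commutesˡ fixed = ≡idᵃ⇒IsIdMod refl
  fixed-commutesˡ flip₀ = ≡idᵃ⇒IsIdMod refl
  fixed-commutesˡ flip₁ = ≡idᵃ⇒IsIdMod refl

  fixed-commutesʳ : ∀ t → IsIdMod N ((⟦ t ⟧ ⨾ ⟦ fixed ⟧) ^ᵃ 2)
  fixed-commutesʳ fixed = ≡idᵃ⇒IsIdMod refl
  fixed-commutesʳ flip₀ = ≡idᵃ⇒IsIdMod refl
  fixed-commutesʳ flip₁ = ≡idᵃ⇒IsIdMod refl

  -- The windows (role K (j ∸ 1), role K j, role K (j + 1)) that occur, with the parities they require.
  r-fixed-fixed-fixed : ∀ b₁ b₂ → IsIdMod N (r-image idᵃ idᵃ idᵃ b₁ b₂ ^ᵃ 2)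
  r-fixed-fixed-fixed true  true  = ≡idᵃ⇒IsIdMod refl
  r-fixed-fixed-fixed true  false = ≡idᵃ⇒IsIdMod refl
  r-fixed-fixed-fixed false true  = ≡idᵃ⇒IsIdMod refl
  r-fixed-fixed-fixed false false = ≡idᵃ⇒IsIdMod refl

  r-fixed-fixed-flip₀ : ∀ b₁ b₂ → IsIdMod N (r-image idᵃ idᵃ ⟦ flip₀ ⟧ b₁ b₂ ^ᵃ 2)
  r-fixed-fixed-flip₀ true  true  = ≡idᵃ⇒IsIdMod refl
  r-fixed-fixed-flip₀ true  false = ≡idᵃ⇒IsIdMod refl
  r-fixed-fixed-flip₀ false true  = ≡idᵃ⇒IsIdMod refl
  r-fixed-fixed-flip₀ false false = ≡idᵃ⇒IsIdMod refl

  r-flip₁-fixed-fixed : ∀ b₁ b₂ → IsIdMod N (r-image ⟦ flip₁ ⟧ idᵃ idᵃ b₁ b₂ ^ᵃ 2)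
  r-flip₁-fixed-fixed true  true  = ≡idᵃ⇒IsIdMod refl
  r-flip₁-fixed-fixed true  false = ≡idᵃ⇒IsIdMod refl
  r-flip₁-fixed-fixed false true  = ≡idᵃ⇒IsIdMod refl
  r-flip₁-fixed-fixed false false = ≡idᵃ⇒IsIdMod refl

  r-fixed-flip₀-flip₁ : ∀ b₂ → IsIdMod N (r-image idᵃ ⟦ flip₀ ⟧ ⟦ flip₁ ⟧ true b₂ ^ᵃ 2)
  r-fixed-flip₀-flip₁ true  = ≡idᵃ⇒IsIdMod refl
  r-fixed-flip₀-flip₁ false = ≡idᵃ⇒IsIdMod refl

  r-flip₀-flip₁-fixed : ∀ b₁ → IsIdMod N (r-image ⟦ flip₀ ⟧ ⟦ flip₁ ⟧ idᵃ b₁ true ^ᵃ 2)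
  r-flip₀-flip₁-fixed true  = ≡idᵃ⇒IsIdMod refl
  r-flip₀-flip₁-fixed false = ≡idᵃ⇒IsIdMod refl

module DihedralRep (m : ℕ) (p : ℕ → ℕ) (K : ℕ) (1≤K : 1 ≤ K) (K≤m : K ≤ m)
                   (even-left : 2 ≤ K → Even (p (K ∸ 1))) (even-right : suc K ≤ m → Even (p (suc K))) where
  open Presentation m p
  open Words m p
  open Actions m p

  τ : ℕ → Aff
  τ j = ⟦ role K j ⟧

  open AffineActions m p (p K) τ

  inv : ∀ j → j ≤ m → IsIdMod (p K) (τ j ^ᵃ 2)
  inv j _ = ⟦⟧-square (role K j)

  comm : ∀ j k → j ≤ m → k ≤ m → Far j k → IsIdMod (p K) ((τ j ⨾ τ k) ^ᵃ 2)
  comm j k _ _ far with role-cases K j | role-cases K k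
  ... | inj₁ fixed-j | _ rewrite fixed-j = fixed-commutesˡ (role K k)
  ... | inj₂ _ | inj₁ fixed-k rewrite fixed-k = fixed-commutesʳ (role K j)
  ... | inj₂ near-j | inj₂ near-k = ⊥-elim (Near-¬Far near-j near-k far)

  pow-p : ∀ j → 1 ≤ j → j ≤ m → IsIdMod (p K) ((τ (j ∸ 1) ⨾ τ j) ^ᵃ p j)
  pow-p (suc J) _ J<m with K ≟ J | K ≟ suc J | K ≟ 2 + J
  ... | yes refl | _ | _ rewrite role-K J | role-fixed J (suc J) 1+n≢n (>⇒≢ (n<2+n J)) =
    reflection-^even-IsIdMod (+ 1) (p (suc J)) (even-right J<m)
  ... | no _ | yes refl | _ rewrite role-pred J | role-K (suc J) = shift-^-IsIdMod (p (suc J))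
  ... | no _ | no _ | yes refl rewrite role-fixed (2 + J) J (<⇒≢ (n<2+n J)) (<⇒≢ (n<1+n (suc J))) | role-pred (suc J) =
    reflection-^even-IsIdMod (+ 0) (p (suc J)) (even-left (s≤s (s≤s z≤n)))
  ... | no K≢J | no K≢1+J | no K≢2+J
    rewrite role-fixed K J (K≢J ∘ sym) (K≢1+J ∘ sym) | role-fixed K (suc J) (K≢1+J ∘ sym) (K≢2+J ∘ sym) =
    idᵃ-^-IsIdMod (p (suc J))

  braid : ∀ j → 1 ≤ j → suc j ≤ m → IsIdMod (p K) (τs (r-indices j (does (2 ∣? p j)) (does (2 ∣? p (suc j)))) ^ᵃ 2)
  braid (suc J) _ J+1<m rewrite τs-r-indices (suc J) (does (2 ∣? p (suc J))) (does (2 ∣? p (2 + J)))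
    with K ≟ J | K ≟ suc J | K ≟ 2 + J | K ≟ 3 + J
  ... | yes refl | _ | _ | _
    rewrite role-K J | role-fixed J (suc J) 1+n≢n (>⇒≢ (n<2+n J))
          | role-fixed J (2 + J) (>⇒≢ (n<2+n J)) (>⇒≢ (m<n⇒m<1+n (n<2+n J))) =
    r-flip₁-fixed-fixed (does (2 ∣? p (suc J))) (does (2 ∣? p (2 + J)))
  ... | no _ | yes refl | _ | _
    rewrite role-pred J | role-K (suc J) | role-fixed (suc J) (2 + J) 1+n≢n (>⇒≢ (n<2+n (suc J)))
          | dec-true (2 ∣? p (2 + J)) (even-right J+1<m) =
    r-flip₀-flip₁-fixed (does (2 ∣? p (suc J)))
  ... | no _ | no _ | yes refl | _
    rewrite role-fixed (2 + J) J (<⇒≢ (n<2+n J)) (<⇒≢ (n<1+n (suc J))) | role-pred (suc J) | role-K (2 + J)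
          | dec-true (2 ∣? p (suc J)) (even-left (s≤s (s≤s z≤n))) =
    r-fixed-flip₀-flip₁ (does (2 ∣? p (2 + J)))
  ... | no _ | no _ | no _ | yes refl
    rewrite role-fixed (3 + J) J (<⇒≢ (m<n⇒m<1+n (n<2+n J))) (<⇒≢ (n<2+n (suc J)))
          | role-fixed (3 + J) (suc J) (<⇒≢ (n<2+n (suc J))) (<⇒≢ (n<1+n (2 + J)))
          | role-pred (2 + J) =
    r-fixed-fixed-flip₀ (does (2 ∣? p (suc J))) (does (2 ∣? p (2 + J)))
  ... | no K≢J | no K≢1+J | no K≢2+J | no K≢3+J
    rewrite role-fixed K J (K≢J ∘ sym) (K≢1+J ∘ sym) | role-fixed K (suc J) (K≢1+J ∘ sym) (K≢2+J ∘ sym)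
          | role-fixed K (2 + J) (K≢2+J ∘ sym) (K≢3+J ∘ sym) =
    r-fixed-fixed-fixed (does (2 ∣? p (suc J))) (does (2 ∣? p (2 + J)))

  dihedral-separates : Separates K
  dihedral-separates = separates inv pow-p comm braid K 1≤K K≤m refl fixes orbit
    where
    fixes : ∀ j → j < K → apply (τ j) (+ 0) ≡ + 0
    fixes j j<K with role-cases K j
    ... | inj₁ fixed-j rewrite fixed-j = refl
    ... | inj₂ (inj₁ j≡K) = ⊥-elim (<-irrefl j≡K j<K)
    ... | inj₂ (inj₂ 1+j≡K) rewrite role-of-pred 1+j≡K = refl
    orbit : ∀ a → a < p K → apply ((τ (K ∸ 1) ⨾ τ K) ^ᵃ a) (+ 0) ≡ + a
    orbit a _ rewrite role-of-pred (m+[n∸m]≡n 1≤K) | role-K K = shift-^-from-0 a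

Conclusion : ℕ → (ℕ → ℕ) → Set
Conclusion m p =
  (∀ i → 1 ≤ i → i ≤ m → Presentation.HasOrder m p (Presentation.y m p i) (p i)) × Presentation.HasCard m p (2 * prodP p m)

slides∧separates⇒Conclusion : ∀ m p (p≥2 : ∀ K → 1 ≤ K → K ≤ m → 2 ≤ p K) → NormalForms.SlidePastBelow m p m →
                              (∀ K → 1 ≤ K → K ≤ m → Actions.Separates m p K) → Conclusion m p
slides∧separates⇒Conclusion m p p≥2 slides separates =
  y-hasOrder separates p≥2 ,
  subst HasCard (normalCount≡2*prodP m)
    (normalForm m , normalForm-injective separates m ≤-refl , normalForm-surjective slides)
  where
  open Presentation m p
  open NormalForms m p
  open Spanning m p p≥2
  open Actions m p

-- Every adjacent pair of exponents contains a 2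

AdjacentTwo : ℕ → (ℕ → ℕ) → Set
AdjacentTwo m p = ∀ i → 1 ≤ i → i < m → p i ≡ 2 ⊎ p (suc i) ≡ 2

module CaseA (m : ℕ) (p : ℕ → ℕ) (p≥2 : ∀ K → 1 ≤ K → K ≤ m → 2 ≤ p K) (adjacent-two : AdjacentTwo m p) where
  open Presentation m p
  open Words m p
  open NormalForms m p
  open Spanning m p p≥2
  open Actions m p

  slide-past : ∀ j → 2 + j ≤ m → SlidePast j
  slide-past j j+2≤m r r<p =
    subst (λ Y → Σ Word λ w → Σ ℕ λ s → LettersUpTo (suc j) w × (pow Y r ++ x j ~ w ++ pow Y s)) (sym y≡D)
      (subst (λ X → Σ Word λ w → Σ ℕ λ s → LettersUpTo (suc j) w × (pow D r ++ X ~ w ++ pow D s)) (sym (x≡letter j j≤m))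
        (by-cases (adjacent-two (suc j) (s≤s z≤n) j+2≤m)))
    where
    j+1≤m = ≤-trans (n≤1+n (suc j)) j+2≤m
    j≤m = ≤-trans (n≤1+n j) j+1≤m
    a = letter (suc j) j+1≤m
    b = letter (2 + j) j+2≤m
    c = letter j j≤m
    open Dihedral m p a b
    y≡D : y (2 + j) ≡ D
    y≡D = cong₂ _++_ (x≡letter (suc j) j+1≤m) (x≡letter (2 + j) j+2≤m)
    c≤1+j : toℕ c ≤ suc j
    c≤1+j = ≤-trans (≤-reflexive (toℕ-letter j j≤m)) (n≤1+n j)
    a≤1+j : toℕ a ≤ suc j
    a≤1+j = ≤-reflexive (toℕ-letter (suc j) j+1≤m)
    bc~cb : b ∷ c ∷ [] ~ c ∷ b ∷ []
    bc~cb = far-commute c b (inj₁ (subst₂ (λ u v → 2 ≤ v ∸ u) (sym (toℕ-letter j j≤m)) (sym (toℕ-letter (2 + j) j+2≤m))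
                                   (≤-reflexive (sym (m+n∸n≡m 2 j)))))
    by-cases : p (suc j) ≡ 2 ⊎ p (2 + j) ≡ 2 →
               Σ Word λ w → Σ ℕ λ s → LettersUpTo (suc j) w × (pow D r ++ c ∷ [] ~ w ++ pow D s)
    by-cases (inj₁ p[j+1]≡2) = c ∷ [] , r , c≤1+j ∷ [] , D^r·c~c·D^r c (commute c a caca~[]) bc~cb r
      where
      caca~[] : c ∷ a ∷ c ∷ a ∷ [] ~ []
      caca~[] = subst₂ (λ X n → pow X n ~ []) (cong₂ _++_ (x≡letter j j≤m) (x≡letter (suc j) j+1≤m)) p[j+1]≡2
                  (relator~[] (rel-p (suc j) (s≤s z≤n) j+1≤m))
    by-cases (inj₂ p[j+2]≡2) = short r (subst (r <_) p[j+2]≡2 r<p)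
      where
      short : ∀ t → t < 2 → Σ Word λ w → Σ ℕ λ s → LettersUpTo (suc j) w × (pow D t ++ c ∷ [] ~ w ++ pow D s)
      short 0 _ = c ∷ [] , 0 , c≤1+j ∷ [] , ~refl
      short 1 _ = a ∷ c ∷ a ∷ [] , 1 , a≤1+j ∷ c≤1+j ∷ a≤1+j ∷ [] , (
        a ∷ b ∷ c ∷ []          ~⟨ ∷-cong a bc~cb ⟩
        a ∷ c ∷ b ∷ []          ~⟨ ~sym (cancel² (a ∷ c ∷ []) a (b ∷ [])) ⟩
        a ∷ c ∷ a ∷ a ∷ b ∷ []  ∎)
      short (suc (suc _)) (s≤s (s≤s ()))

  2∣2 : Even 2
  2∣2 = divides 1 refl

  separates : ∀ K → 1 ≤ K → K ≤ m → Separates K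
  separates K 1≤K K≤m with p K ≟ 2
  ... | yes pK≡2 = parity-separates K 1≤K K≤m pK≡2
  ... | no pK≢2 = DihedralRep.dihedral-separates m p K 1≤K K≤m even-left even-right
    where
    even-left : 2 ≤ K → Even (p (K ∸ 1))
    even-left 2≤K with adjacent-two (K ∸ 1) (∸-monoˡ-≤ 1 2≤K) (subst (_≤ m) (sym (m+[n∸m]≡n 1≤K)) K≤m)
    ... | inj₁ p[K-1]≡2 = subst Even (sym p[K-1]≡2) 2∣2
    ... | inj₂ pK≡2 = ⊥-elim (pK≢2 (subst (λ t → p t ≡ 2) (m+[n∸m]≡n 1≤K) pK≡2))
    even-right : suc K ≤ m → Even (p (suc K))
    even-right K<m with adjacent-two K 1≤K K<m
    ... | inj₁ pK≡2 = ⊥-elim (pK≢2 pK≡2)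
    ... | inj₂ p[K+1]≡2 = subst Even (sym p[K+1]≡2) 2∣2

-- The case n − 1 = 2

module CaseBSlides (p : ℕ → ℕ) where
  open Presentation 2 p
  open Words 2 p
  open NormalForms 2 p

  ℓ₀ ℓ₁ ℓ₂ : Fin 3
  ℓ₀ = fzero
  ℓ₁ = fsuc fzero
  ℓ₂ = fsuc (fsuc fzero)

  Y u : Word
  Y = ℓ₁ ∷ ℓ₂ ∷ []
  u = ℓ₁ ∷ ℓ₀ ∷ ℓ₁ ∷ []

  Y·ℓ₀~u·Y : Y ++ ℓ₀ ∷ [] ~ u ++ Y
  Y·ℓ₀~u·Y =
    ℓ₁ ∷ ℓ₂ ∷ ℓ₀ ∷ []           ~⟨ ∷-cong ℓ₁ (far-commute ℓ₀ ℓ₂ (inj₁ (s≤s (s≤s z≤n)))) ⟩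
    ℓ₁ ∷ ℓ₀ ∷ ℓ₂ ∷ []           ~⟨ ~sym (cancel² (ℓ₁ ∷ ℓ₀ ∷ []) ℓ₁ (ℓ₂ ∷ [])) ⟩
    ℓ₁ ∷ ℓ₀ ∷ ℓ₁ ∷ ℓ₁ ∷ ℓ₂ ∷ []  ∎

  reverse-of-square : ∀ X → pow X 2 ~ [] → X ~ reverse X
  reverse-of-square X X²~[] = ~sym (
    reverse X               ~⟨ ++-congʳ (reverse X) (~sym (subst (_~ []) (cong (X ++_) (++-identityʳ X)) X²~[])) ⟩
    (X ++ X) ++ reverse X   ≡⟨ ++-assoc X X (reverse X) ⟩
    X ++ X ++ reverse X     ~⟨ ++-congˡ X (++-reverse~[] X) ⟩
    X ++ []                 ≡⟨ ++-identityʳ X ⟩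
    X                       ∎)

  r₁-reverse : ∀ {b₁ b₂} → does (2 ∣? p 1) ≡ b₁ → does (2 ∣? p 2) ≡ b₂ →
               xs (r-indices 1 b₁ b₂) ~ reverse (xs (r-indices 1 b₁ b₂))
  r₁-reverse refl refl = reverse-of-square _ (subst (_~ []) (r≡pow 1) (relator~[] (rel-r 1 (s≤s z≤n) ≤-refl)))

  module SlideBySquares (V : Word) (Y²·ℓ₀~ℓ₀·V : pow Y 2 ++ ℓ₀ ∷ [] ~ ℓ₀ ∷ V)
                        (V^c~Y^s : ∀ c → Σ ℕ λ s → pow V c ~ pow Y s) where

    Y^2c·ℓ₀ : ∀ c → pow Y (c * 2) ++ ℓ₀ ∷ [] ~ ℓ₀ ∷ pow V c
    Y^2c·ℓ₀ zero = ~refl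
    Y^2c·ℓ₀ (suc c) =
      pow Y 2 ++ (pow Y (c * 2) ++ ℓ₀ ∷ []) ~⟨ ++-congˡ (pow Y 2) (Y^2c·ℓ₀ c) ⟩
      (pow Y 2 ++ ℓ₀ ∷ []) ++ pow V c       ~⟨ ++-congʳ (pow V c) Y²·ℓ₀~ℓ₀·V ⟩
      ℓ₀ ∷ V ++ pow V c                     ∎

    Y^2c+1·ℓ₀ : ∀ c → pow Y (suc (c * 2)) ++ ℓ₀ ∷ [] ~ u ++ Y ++ pow V c
    Y^2c+1·ℓ₀ c =
      Y ++ (pow Y (c * 2) ++ ℓ₀ ∷ []) ~⟨ ++-congˡ Y (Y^2c·ℓ₀ c) ⟩
      (Y ++ ℓ₀ ∷ []) ++ pow V c       ~⟨ ++-congʳ (pow V c) Y·ℓ₀~u·Y ⟩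
      (u ++ Y) ++ pow V c             ∎

    slide-past : SlidePast 0
    slide-past r _ with even-or-odd r
    ... | c , inj₁ refl = ℓ₀ ∷ [] , proj₁ (V^c~Y^s c) , z≤n ∷ [] , ~trans (Y^2c·ℓ₀ c) (∷-cong ℓ₀ (proj₂ (V^c~Y^s c)))
    ... | c , inj₂ refl = u , suc (proj₁ (V^c~Y^s c)) , s≤s z≤n ∷ z≤n ∷ s≤s z≤n ∷ [] ,
                          ~trans (Y^2c+1·ℓ₀ c) (++-congˡ u (++-congˡ Y (proj₂ (V^c~Y^s c))))

  slide-even-even : does (2 ∣? p 1) ≡ true → does (2 ∣? p 2) ≡ true → SlidePast 0
  slide-even-even e₁ e₂ = SlideBySquares.slide-past (pow Y 2) Y²·ℓ₀~ℓ₀·Y² (λ c → c * 2 , ≡⇒~ (sym (pow-* Y c 2)))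
    where
    Y·u~ℓ₀·Y : Y ++ u ~ ℓ₀ ∷ Y
    Y·u~ℓ₀·Y =
      ℓ₁ ∷ ℓ₂ ∷ ℓ₁ ∷ ℓ₀ ∷ ℓ₁ ∷ []  ~⟨ ++-congʳ (ℓ₁ ∷ []) (~sym (r₁-reverse e₁ e₂)) ⟩
      ℓ₀ ∷ ℓ₁ ∷ ℓ₂ ∷ ℓ₁ ∷ ℓ₁ ∷ []  ~⟨ cancel² (ℓ₀ ∷ ℓ₁ ∷ ℓ₂ ∷ []) ℓ₁ [] ⟩
      ℓ₀ ∷ ℓ₁ ∷ ℓ₂ ∷ []            ∎
    Y²·ℓ₀~ℓ₀·Y² : pow Y 2 ++ ℓ₀ ∷ [] ~ ℓ₀ ∷ pow Y 2
    Y²·ℓ₀~ℓ₀·Y² =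
      Y ++ (Y ++ ℓ₀ ∷ [])  ~⟨ ++-congˡ Y Y·ℓ₀~u·Y ⟩
      (Y ++ u) ++ Y        ~⟨ ++-congʳ Y Y·u~ℓ₀·Y ⟩
      ℓ₀ ∷ Y ++ Y          ∎

  slide-odd-even : does (2 ∣? p 1) ≡ false → does (2 ∣? p 2) ≡ true → 1 ≤ p 2 → SlidePast 0
  slide-odd-even e₁ e₂ 1≤p₂ = SlideBySquares.slide-past (pow E 2) Y²·ℓ₀~ℓ₀·E²
    (λ c → c * 2 * (p 2 ∸ 1) , ~trans (≡⇒~ (sym (pow-* E c 2))) (E^r~D^[r*[P∸1]] (c * 2)))
    where
    open Dihedral 2 p ℓ₁ ℓ₂
    open OfOrder (p 2) 1≤p₂ (relator~[] (rel-p 2 (s≤s z≤n) ≤-refl))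
    Y²·ℓ₀~ℓ₀·E² : pow Y 2 ++ ℓ₀ ∷ [] ~ ℓ₀ ∷ pow E 2
    Y²·ℓ₀~ℓ₀·E² =
      ℓ₁ ∷ ℓ₂ ∷ ℓ₁ ∷ ℓ₂ ∷ ℓ₀ ∷ []            ~⟨ ~sym (cancel² [] ℓ₀ _) ⟩
      ℓ₀ ∷ ℓ₀ ∷ ℓ₁ ∷ ℓ₂ ∷ ℓ₁ ∷ ℓ₂ ∷ ℓ₀ ∷ []  ~⟨ ∷-cong ℓ₀ (++-congʳ (ℓ₀ ∷ []) (r₁-reverse e₁ e₂)) ⟩
      ℓ₀ ∷ ℓ₂ ∷ ℓ₁ ∷ ℓ₂ ∷ ℓ₁ ∷ ℓ₀ ∷ ℓ₀ ∷ []  ~⟨ cancel² (ℓ₀ ∷ ℓ₂ ∷ ℓ₁ ∷ ℓ₂ ∷ ℓ₁ ∷ []) ℓ₀ [] ⟩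
      ℓ₀ ∷ ℓ₂ ∷ ℓ₁ ∷ ℓ₂ ∷ ℓ₁ ∷ []            ∎

  slide-even-odd : does (2 ∣? p 1) ≡ true → does (2 ∣? p 2) ≡ false → SlidePast 0
  slide-even-odd e₁ e₂ r _ = ℓ₀ ∷ pow q r , r , z≤n ∷ LettersUpTo-pow r (z≤n ∷ s≤s z≤n ∷ z≤n ∷ s≤s z≤n ∷ []) , Y^r·ℓ₀ r
    where
    q : Word
    q = ℓ₀ ∷ ℓ₁ ∷ ℓ₀ ∷ ℓ₁ ∷ []
    Y·q~q·Y : Y ++ q ~ q ++ Y
    Y·q~q·Y =
      ℓ₁ ∷ ℓ₂ ∷ ℓ₀ ∷ ℓ₁ ∷ ℓ₀ ∷ ℓ₁ ∷ []            ~⟨ ~sym (++-congˡ (Y ++ q) (letter²~[] ℓ₂)) ⟩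
      ℓ₁ ∷ ℓ₂ ∷ ℓ₀ ∷ ℓ₁ ∷ ℓ₀ ∷ ℓ₁ ∷ ℓ₂ ∷ ℓ₂ ∷ []  ~⟨ ++-congˡ Y (++-congʳ (ℓ₂ ∷ []) (~sym (r₁-reverse e₁ e₂))) ⟩
      ℓ₁ ∷ ℓ₂ ∷ ℓ₂ ∷ ℓ₁ ∷ ℓ₀ ∷ ℓ₁ ∷ ℓ₀ ∷ ℓ₂ ∷ []  ~⟨ cancel² (ℓ₁ ∷ []) ℓ₂ _ ⟩
      ℓ₁ ∷ ℓ₁ ∷ ℓ₀ ∷ ℓ₁ ∷ ℓ₀ ∷ ℓ₂ ∷ []            ~⟨ cancel² [] ℓ₁ _ ⟩
      ℓ₀ ∷ ℓ₁ ∷ ℓ₀ ∷ ℓ₂ ∷ []                      ~⟨ ~sym (cancel² (ℓ₀ ∷ ℓ₁ ∷ ℓ₀ ∷ []) ℓ₁ (ℓ₂ ∷ [])) ⟩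
      ℓ₀ ∷ ℓ₁ ∷ ℓ₀ ∷ ℓ₁ ∷ ℓ₁ ∷ ℓ₂ ∷ []            ∎
    Y·q^n~q^n·Y : ∀ n → Y ++ pow q n ~ pow q n ++ Y
    Y·q^n~q^n·Y zero = ~refl
    Y·q^n~q^n·Y (suc n) =
      (Y ++ q) ++ pow q n    ~⟨ ++-congʳ (pow q n) Y·q~q·Y ⟩
      q ++ Y ++ pow q n      ~⟨ ++-congˡ q (Y·q^n~q^n·Y n) ⟩
      q ++ (pow q n ++ Y)    ≡⟨ sym (++-assoc q (pow q n) Y) ⟩
      (q ++ pow q n) ++ Y    ∎
    Y^r·ℓ₀ : ∀ r → pow Y r ++ ℓ₀ ∷ [] ~ (ℓ₀ ∷ pow q r) ++ pow Y r
    Y^r·ℓ₀ zero = ~refl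
    Y^r·ℓ₀ (suc r) =
      Y ++ (pow Y r ++ ℓ₀ ∷ [])                ~⟨ ++-congˡ Y (Y^r·ℓ₀ r) ⟩
      (Y ++ ℓ₀ ∷ []) ++ pow q r ++ pow Y r     ~⟨ ++-congʳ (pow q r ++ pow Y r) Y·ℓ₀~u·Y ⟩
      u ++ (Y ++ pow q r) ++ pow Y r           ~⟨ ++-congˡ u (++-congʳ (pow Y r) (Y·q^n~q^n·Y r)) ⟩
      u ++ (pow q r ++ Y) ++ pow Y r           ~⟨ ++-congʳ ((pow q r ++ Y) ++ pow Y r) (~sym (cancel² [] ℓ₀ u)) ⟩
      ℓ₀ ∷ q ++ (pow q r ++ Y) ++ pow Y r      ≡⟨ cong (ℓ₀ ∷_) (trans (cong (q ++_) (++-assoc (pow q r) Y (pow Y r)))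
                                                                      (sym (++-assoc q (pow q r) (Y ++ pow Y r)))) ⟩
      ℓ₀ ∷ (q ++ pow q r) ++ Y ++ pow Y r      ∎

module EvenOddRep (p : ℕ → ℕ) (d a f : ℕ) (p₁≡d*2 : p 1 ≡ d * 2) (p₂≡a*d : p 2 ≡ a * d) (d≡1+f*2 : d ≡ suc (f * 2))
                  (e₁ : does (2 ∣? p 1) ≡ true) (e₂ : does (2 ∣? p 2) ≡ false) where
  open Actions 2 p

  τ : ℕ → Aff
  τ 0 = false , + 0
  τ 1 = false , + 1
  τ 2 = false , + d
  τ (suc (suc (suc _))) = idᵃ

  open AffineActions 2 p (p 1) τ

  inv : ∀ j → j ≤ 2 → IsIdMod (p 1) (τ j ^ᵃ 2)
  inv 0 _ = reflection-^2-IsIdMod (τ 0) refl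
  inv 1 _ = reflection-^2-IsIdMod (τ 1) refl
  inv 2 _ = reflection-^2-IsIdMod (τ 2) refl
  inv (suc (suc (suc _))) (s≤s (s≤s ()))

  +p₁ : + p 1 ≡ + d *ℤ + 2
  +p₁ = trans (cong +_ p₁≡d*2) (ℤ.pos-* d 2)

  -- p₂ (d − 1) = a d · 2f = a f · p₁
  p₂·[d-1]≡af·p₁ : + p 2 *ℤ (+ d -ℤ + 1) ≡ + (a * f) *ℤ + p 1
  p₂·[d-1]≡af·p₁ = begin
    + p 2 *ℤ (+ d -ℤ + 1)             ≡⟨ cong (λ t → + p 2 *ℤ (+ t -ℤ + 1)) d≡1+f*2 ⟩
    + p 2 *ℤ (+ suc (f * 2) -ℤ + 1)   ≡⟨ cong (+ p 2 *ℤ_) (1+n-1 (+ (f * 2))) ⟩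
    + p 2 *ℤ + (f * 2)                ≡⟨ sym (ℤ.pos-* (p 2) (f * 2)) ⟩
    + (p 2 * (f * 2))                 ≡⟨ cong +_ p₂*2f≡af*p₁ ⟩
    + (a * f * p 1)                   ≡⟨ ℤ.pos-* (a * f) (p 1) ⟩
    + (a * f) *ℤ + p 1                ∎
    where
    open ≡-Reasoning
    1+n-1 : ∀ n → (+ 1 +ℤ n) -ℤ + 1 ≡ n
    1+n-1 = solve-∀
    p₂*2f≡af*p₁ : p 2 * (f * 2) ≡ a * f * p 1
    p₂*2f≡af*p₁ rewrite p₂≡a*d | p₁≡d*2 = lemma a d f
      where lemma : ∀ a d f → a * d * (f * 2) ≡ a * f * (d * 2)
            lemma = ℕ-solve-∀

  pow-p : ∀ j → 1 ≤ j → j ≤ 2 → IsIdMod (p 1) ((τ (j ∸ 1) ⨾ τ j) ^ᵃ p j)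
  pow-p 1 _ _ = shift-^-IsIdMod (p 1)
  pow-p 2 _ _ = translation-^-IsIdMod (p 1) (+ d -ℤ + 1) (p 2) (+ (a * f)) p₂·[d-1]≡af·p₁
  pow-p (suc (suc (suc _))) _ (s≤s (s≤s ()))

  comm : ∀ j k → j ≤ 2 → k ≤ 2 → Far j k → IsIdMod (p 1) ((τ j ⨾ τ k) ^ᵃ 2)
  comm j k _ k≤2 (inj₁ far) with far-within-2 {j} {k} far k≤2
  ... | refl , refl = translation-^-IsIdMod (p 1) (+ d -ℤ + 0) 2 (+ 1) (trans (lemma (+ d)) (cong (+ 1 *ℤ_) (sym +p₁)))
    where lemma : ∀ D → + 2 *ℤ (D -ℤ + 0) ≡ + 1 *ℤ (D *ℤ + 2)
          lemma = solve-∀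
  comm j k j≤2 _ (inj₂ far) with far-within-2 {k} {j} far j≤2
  ... | refl , refl = translation-^-IsIdMod (p 1) (+ 0 -ℤ + d) 2 (-ℤ + 1) (trans (lemma (+ d)) (cong (-ℤ + 1 *ℤ_) (sym +p₁)))
    where lemma : ∀ D → + 2 *ℤ (+ 0 -ℤ D) ≡ -ℤ + 1 *ℤ (D *ℤ + 2)
          lemma = solve-∀

  braid : ∀ j → 1 ≤ j → suc j ≤ 2 → IsIdMod (p 1) (τs (r-indices j (does (2 ∣? p j)) (does (2 ∣? p (suc j)))) ^ᵃ 2)
  braid 1 _ _ = subst₂ (λ b₁ b₂ → IsIdMod (p 1) (τs (r-indices 1 b₁ b₂) ^ᵃ 2)) (sym e₁) (sym e₂)
                       (reflection-^2-IsIdMod (τs (r-indices 1 true false)) refl)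
  braid (suc (suc _)) _ (s≤s (s≤s ()))

  even-odd-separates : Separates 1
  even-odd-separates = separates inv pow-p comm braid 1 (s≤s z≤n) (s≤s z≤n) refl fixes (λ a _ → shift-^-from-0 a)
    where
    fixes : ∀ j → j < 1 → apply (τ j) (+ 0) ≡ + 0
    fixes 0 _ = refl
    fixes (suc _) (s≤s ())

module OddEvenRep (p : ℕ → ℕ) (d a : ℕ) (p₂≡d*2 : p 2 ≡ d * 2) (p₁≡a*d : p 1 ≡ a * d)
                  (e₁ : does (2 ∣? p 1) ≡ false) (e₂ : does (2 ∣? p 2) ≡ true) where
  open Presentation 2 p
  open Words 2 p
  open Actions 2 p
  open CaseBSlides p using (ℓ₀; ℓ₁; ℓ₂; Y)

  -- Two copies of ℤ/d swapped by x₂; y₂² translates each copy by 1, and y₂ alternates between them.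
  act : Fin 3 → Bool × ℤ → Bool × ℤ
  act fzero (b , z) = b , apply (false , + 0) z
  act (fsuc fzero) (false , z) = false , apply (false , + 0) z
  act (fsuc fzero) (true , z) = true , apply (false , -ℤ + 1) z
  act (fsuc (fsuc fzero)) (b , z) = not b , apply (false , + 0) z

  points : Setoid 0ℓ 0ℓ
  points = setoid Bool ×ₛ ℤ-mod d

  open Setoid points using (_≈_) renaming (refl to ≈-refl; trans to ≈-trans)

  act-cong : ∀ c {pt pt'} → pt ≈ pt' → act c pt ≈ act c pt'
  act-cong fzero (refl , z≡z') = refl , apply-cong (false , + 0) z≡z'
  act-cong (fsuc fzero) {false , _} (refl , z≡z') = refl , apply-cong (false , + 0) z≡z'
  act-cong (fsuc fzero) {true , _} (refl , z≡z') = refl , apply-cong (false , -ℤ + 1) z≡z'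
  act-cong (fsuc (fsuc fzero)) (refl , z≡z') = refl , apply-cong (false , + 0) z≡z'

  ≡⇒≈ : ∀ {pt pt'} → pt ≡ pt' → pt ≈ pt'
  ≡⇒≈ refl = ≈-refl

  iterate-on-fibre : ∀ W b g → (∀ z → act* act W (b , z) ≡ (b , apply g z)) →
                     ∀ n z → act* act (pow W n) (b , z) ≡ (b , apply (g ^ᵃ n) z)
  iterate-on-fibre W b g step zero z = cong (b ,_) (sym (ℤ.+-identityʳ z))
  iterate-on-fibre W b g step (suc n) z =
    trans (act*-++ act W (pow W n) (b , z)) (trans (cong (act* act (pow W n)) (step z))
      (trans (iterate-on-fibre W b g step n (apply g z)) (cong (b ,_) (sym (apply-⨾ g (g ^ᵃ n) z)))))

  Y²-step : ∀ b z → act* act (pow Y 2) (b , z) ≡ (b , apply (true , + 1) z)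
  Y²-step false z = cong (false ,_) (lemma z)
    where lemma : ∀ z → + 0 -ℤ (-ℤ + 1 -ℤ (+ 0 -ℤ (+ 0 -ℤ z))) ≡ z +ℤ + 1
          lemma = solve-∀
  Y²-step true z = cong (true ,_) (lemma z)
    where lemma : ∀ z → + 0 -ℤ (+ 0 -ℤ (+ 0 -ℤ (-ℤ + 1 -ℤ z))) ≡ z +ℤ + 1
          lemma = solve-∀

  Y^2n : ∀ n b z → act* act (pow Y (n * 2)) (b , z) ≡ (b , apply ((true , + 1) ^ᵃ n) z)
  Y^2n n b z = trans (cong (λ w → act* act w (b , z)) (pow-* Y n 2)) (iterate-on-fibre (pow Y 2) b _ (Y²-step b) n z)

  reflection₀⁴ : ∀ z → apply (false , + 0) (apply (false , + 0) (apply (false , + 0) (apply (false , + 0) z))) ≡ z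
  reflection₀⁴ z = trans (reflection-involutive (+ 0) _) (reflection-involutive (+ 0) z)

  x₀x₁-pow-fixes : ∀ pt → act* act (pow (ℓ₀ ∷ ℓ₁ ∷ []) (p 1)) pt ≈ pt
  x₀x₁-pow-fixes (false , z) =
    ≈-trans (≡⇒≈ (iterate-on-fibre (ℓ₀ ∷ ℓ₁ ∷ []) false idᵃ
                   (λ z → cong (false ,_) (trans (reflection-involutive (+ 0) z) (sym (ℤ.+-identityʳ z)))) (p 1) z))
      (refl , IsIdMod.apply≡[]id (idᵃ-^-IsIdMod (p 1)) z)
  x₀x₁-pow-fixes (true , z) =
    ≈-trans (≡⇒≈ (iterate-on-fibre (ℓ₀ ∷ ℓ₁ ∷ []) true (true , -ℤ + 1) (λ z → cong (true ,_) (lemma z)) (p 1) z))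
      (refl , IsIdMod.apply≡[]id (translation-^-IsIdMod d (-ℤ + 1) (p 1) (-ℤ + a) p₁·-1≡-a·d) z)
    where
    lemma : ∀ z → -ℤ + 1 -ℤ (+ 0 -ℤ z) ≡ z +ℤ -ℤ + 1
    lemma = solve-∀
    p₁·-1≡-a·d : + p 1 *ℤ -ℤ + 1 ≡ -ℤ + a *ℤ + d
    p₁·-1≡-a·d = trans (cong (λ n → + n *ℤ -ℤ + 1) p₁≡a*d) (trans (cong (_*ℤ -ℤ + 1) (ℤ.pos-* a d)) (lemma′ (+ a) (+ d)))
      where lemma′ : ∀ a d → a *ℤ d *ℤ -ℤ + 1 ≡ -ℤ a *ℤ d
            lemma′ = solve-∀

  y₂-pow-fixes : ∀ pt → act* act (pow Y (p 2)) pt ≈ pt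
  y₂-pow-fixes (b , z) =
    ≈-trans (≡⇒≈ (trans (cong (λ n → act* act (pow Y n) (b , z)) p₂≡d*2) (Y^2n d b z)))
      (refl , IsIdMod.apply≡[]id (shift-^-IsIdMod d) z)

  x₀x₂-square-fixes : ∀ pt → act* act (pow (ℓ₀ ∷ ℓ₂ ∷ []) 2) pt ≈ pt
  x₀x₂-square-fixes (b , z) = not-involutive b , ≡⇒≡[] (reflection₀⁴ z)

  x₂x₀-square-fixes : ∀ pt → act* act (pow (ℓ₂ ∷ ℓ₀ ∷ []) 2) pt ≈ pt
  x₂x₀-square-fixes (b , z) = not-involutive b , ≡⇒≡[] (reflection₀⁴ z)

  r₁-fixes : ∀ pt → act* act (r 1) pt ≈ pt
  r₁-fixes pt =
    subst (λ w → act* act w pt ≈ pt) (sym (trans (r≡pow 1) (cong₂ (λ b₁ b₂ → pow (xs (r-indices 1 b₁ b₂)) 2) e₁ e₂)))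
      (X²-fixes pt)
    where
    X : Word
    X = ℓ₀ ∷ pow Y 2
    g : Aff
    g = (false , + 0) ⨾ (true , + 1)
    X²-fixes : ∀ pt → act* act (pow X 2) pt ≈ pt
    X²-fixes (b , z) =
      ≈-trans (≡⇒≈ (iterate-on-fibre X b g
                     (λ z → trans (Y²-step b _) (cong (b ,_) (sym (apply-⨾ (false , + 0) (true , + 1) z)))) 2 z))
        (refl , IsIdMod.apply≡[]id (reflection-^2-IsIdMod g refl) z)

  relator-fixes : ∀ {ρ} → IsRelator ρ → ∀ pt → act* act ρ pt ≈ pt
  relator-fixes (rel-inv 0 _) (b , z) = refl , ≡⇒≡[] (reflection-involutive (+ 0) z)
  relator-fixes (rel-inv 1 _) (false , z) = refl , ≡⇒≡[] (reflection-involutive (+ 0) z)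
  relator-fixes (rel-inv 1 _) (true , z) = refl , ≡⇒≡[] (reflection-involutive (-ℤ + 1) z)
  relator-fixes (rel-inv 2 _) (b , z) = not-involutive b , ≡⇒≡[] (reflection-involutive (+ 0) z)
  relator-fixes (rel-inv (suc (suc (suc _))) (s≤s (s≤s ())))
  relator-fixes (rel-p 1 _ _) = x₀x₁-pow-fixes
  relator-fixes (rel-p 2 _ _) = y₂-pow-fixes
  relator-fixes (rel-p (suc (suc (suc _))) _ (s≤s (s≤s ())))
  relator-fixes (rel-comm j k _ k≤2 (inj₁ far)) with far-within-2 {j} {k} far k≤2
  ... | refl , refl = x₀x₂-square-fixes
  relator-fixes (rel-comm j k j≤2 _ (inj₂ far)) with far-within-2 {k} {j} far j≤2
  ... | refl , refl = x₂x₀-square-fixes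
  relator-fixes (rel-r 1 _ _) = r₁-fixes
  relator-fixes (rel-r (suc (suc n)) _ n+4≤3) = ⊥-elim (1+n≰n (m+n≤o⇒n≤o n (≤-pred (≤-pred n+4≤3))))

  action : Action
  action = record { points = points ; act = act ; act-cong = act-cong ; relator-fixes = relator-fixes }

  orbit : ∀ n → Σ ℕ λ c → (n ≡ c * 2 × act* act (pow Y n) (false , + 0) ≡ (false , + c))
                        ⊎ (n ≡ suc (c * 2) × act* act (pow Y n) (false , + 0) ≡ (true , + c))
  orbit n with even-or-odd n
  ... | c , inj₁ refl = c , inj₁ (refl , trans (Y^2n c false (+ 0)) (cong (false ,_) (shift-^-from-0 c)))
  ... | c , inj₂ refl = c , inj₂ (refl , trans (Y^2n c true (+ 0)) (cong (true ,_) (shift-^-from-0 c)))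

  odd-even-separates : Separates 2
  odd-even-separates = record
    { action = action
    ; base = false , + 0
    ; fixed-below = λ { fzero _ → ≈-refl ; (fsuc fzero) _ → ≈-refl ; (fsuc (fsuc fzero)) (s≤s (s≤s ())) }
    ; y-orbit-injective = injective
    }
    where
    half< : ∀ {c n} → n < p 2 → c * 2 ≤ n → c < d
    half< {c} n<p c*2≤n = *-cancelʳ-< 2 c d (≤-<-trans c*2≤n (subst (_ <_) p₂≡d*2 n<p))
    injective : ∀ n n' → n < p 2 → n' < p 2 → act* act (pow Y n) (false , + 0) ≈ act* act (pow Y n') (false , + 0) → n ≡ n'
    injective n n' n<p n'<p e with orbit n | orbit n'
    ... | c , inj₁ (refl , at) | c' , inj₁ (refl , at') rewrite at | at' =
      cong (_* 2) (≡[]⇒≡ (half< n<p ≤-refl) (half< n'<p ≤-refl) (proj₂ e))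
    ... | c , inj₂ (refl , at) | c' , inj₂ (refl , at') rewrite at | at' =
      cong (λ c → suc (c * 2)) (≡[]⇒≡ (half< n<p (n≤1+n _)) (half< n'<p (n≤1+n _)) (proj₂ e))
    ... | c , inj₁ (refl , at) | c' , inj₂ (refl , at') rewrite at | at' with proj₁ e
    ...   | ()
    injective n n' n<p n'<p e | c , inj₂ (refl , at) | c' , inj₁ (refl , at') rewrite at | at' with proj₁ e
    ...   | ()

case-B : ∀ p → Admissible 2 p → Conclusion 2 p
case-B p (p≥2 , odd⇒even-neighbours) = by-parity (2 ∣? p 1) (2 ∣? p 2) refl refl
  where
  open NormalForms 2 p using (SlidePast; SlidePastBelow)
  open Actions 2 p using (Separates)
  open CaseBSlides p

  slides : SlidePast 0 → SlidePastBelow 2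
  slides slide-past 0 _ = slide-past
  slides _ (suc _) (s≤s (s≤s ()))

  separating : Separates 1 → Separates 2 → ∀ K → 1 ≤ K → K ≤ 2 → Separates K
  separating s₁ _ 1 _ _ = s₁
  separating _ s₂ 2 _ _ = s₂
  separating _ _ (suc (suc (suc _))) _ (s≤s (s≤s ()))

  dihedral₁ : Even (p 2) → Separates 1
  dihedral₁ even₂ = DihedralRep.dihedral-separates 2 p 1 (s≤s z≤n) (s≤s z≤n) (λ { (s≤s ()) }) (λ _ → even₂)

  dihedral₂ : Even (p 1) → Separates 2
  dihedral₂ even₁ = DihedralRep.dihedral-separates 2 p 2 (s≤s z≤n) ≤-refl (λ _ → even₁) (λ { (s≤s (s≤s ())) })

  by-parity : (d₁ : Dec (Even (p 1))) (d₂ : Dec (Even (p 2))) →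
              does (2 ∣? p 1) ≡ does d₁ → does (2 ∣? p 2) ≡ does d₂ → Conclusion 2 p
  by-parity (yes even₁) (yes even₂) e₁ e₂ =
    slides∧separates⇒Conclusion 2 p p≥2 (slides (slide-even-even e₁ e₂)) (separating (dihedral₁ even₂) (dihedral₂ even₁))
  by-parity (no odd₁) (yes (divides d p₂≡d*2)) e₁ e₂ =
    slides∧separates⇒Conclusion 2 p p≥2 (slides (slide-odd-even e₁ e₂ (≤-trans (s≤s z≤n) (p≥2 2 (s≤s z≤n) ≤-refl))))
      (separating (dihedral₁ (divides d p₂≡d*2)) (OddEvenRep.odd-even-separates p d a p₂≡d*2 p₁≡a*d e₁ e₂))
    where
    p₂∣2p₁ = proj₂ (proj₂ (odd⇒even-neighbours 1 (s≤s z≤n) (s≤s z≤n) odd₁) (s≤s (s≤s z≤n)))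
    a = proj₁ (quotient-of-double (p 1) d (subst (_∣ 2 * p 1) p₂≡d*2 p₂∣2p₁))
    p₁≡a*d = proj₂ (quotient-of-double (p 1) d (subst (_∣ 2 * p 1) p₂≡d*2 p₂∣2p₁))
  by-parity (yes (divides d p₁≡d*2)) (no odd₂) e₁ e₂ =
    slides∧separates⇒Conclusion 2 p p≥2 (slides (slide-even-odd e₁ e₂))
      (separating (EvenOddRep.even-odd-separates p d a f p₁≡d*2 p₂≡a*d d≡1+f*2 e₁ e₂) (dihedral₂ (divides d p₁≡d*2)))
    where
    p₁∣2p₂ = proj₂ (proj₁ (odd⇒even-neighbours 2 (s≤s z≤n) ≤-refl odd₂) ≤-refl)
    a = proj₁ (quotient-of-double (p 2) d (subst (_∣ 2 * p 2) p₁≡d*2 p₁∣2p₂))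
    p₂≡a*d = proj₂ (quotient-of-double (p 2) d (subst (_∣ 2 * p 2) p₁≡d*2 p₁∣2p₂))
    d-odd : Σ ℕ λ f → d ≡ suc (f * 2)
    d-odd with even-or-odd d
    ... | f , inj₂ d≡1+2f = f , d≡1+2f
    ... | f , inj₁ d≡2f = ⊥-elim (odd₂ (divides (a * f) (trans p₂≡a*d (trans (cong (a *_) d≡2f) (sym (*-assoc a f 2))))))
    f = proj₁ d-odd
    d≡1+f*2 = proj₂ d-odd
  by-parity (no odd₁) (no odd₂) _ _ =
    ⊥-elim (odd₂ (proj₁ (proj₂ (odd⇒even-neighbours 1 (s≤s z≤n) (s≤s z≤n) odd₁) (s≤s (s≤s z≤n)))))

case-A : ∀ m p → Admissible m p → AdjacentTwo m p → Conclusion m p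
case-A m p (p≥2 , _) adjacent-two = slides∧separates⇒Conclusion m p p≥2 slide-past separates
  where open CaseA m p p≥2 adjacent-two

hypothesis⇒AdjacentTwo : ∀ m p → m ≢ 2 → (∀ i → 1 < i → i < m → p i ≡ 2 ⊎ (p (i ∸ 1) ≡ 2 × p (i + 1) ≡ 2)) → AdjacentTwo m p
hypothesis⇒AdjacentTwo m p m≢2 hyp 1 _ 1<m with hyp 2 ≤-refl (≤∧≢⇒< 1<m (m≢2 ∘ sym))
... | inj₁ p₂≡2 = inj₂ p₂≡2
... | inj₂ (p₁≡2 , _) = inj₁ p₁≡2
hypothesis⇒AdjacentTwo m p _ hyp (suc (suc i)) _ i+2<m with hyp (2 + i) (s≤s (s≤s z≤n)) i+2<m
... | inj₁ p≡2 = inj₁ p≡2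
... | inj₂ (_ , p≡2) = inj₂ (subst (λ t → p t ≡ 2) (+-comm (2 + i) 1) p≡2)

proposition4p3 : (m : ℕ) → 1 ≤ m → (p : ℕ → ℕ) → Admissible m p →
    (∀ i → 1 < i → i < m → p i ≡ 2 ⊎ (p (i ∸ 1) ≡ 2 × p (i + 1) ≡ 2)) →
    (∀ i → 1 ≤ i → i ≤ m → Presentation.HasOrder m p (Presentation.y m p i) (p i))
    × Presentation.HasCard m p (2 * prodP p m)
proposition4p3 m _ p admissible hyp with m ≟ 2
... | yes refl = case-B p admissible
... | no m≢2 = case-A m p admissible (hypothesis⇒AdjacentTwo m p m≢2 hyp)
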